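{- Let $b\in\mathbb{N}$ and let $f_0=(f_0(j))_{j\ge1}$ be a sequence of nonnegative integers with $f_0(j)\le b^{j-1}$ for every $j$. For each $j\ge1$ let $W_b(j)$ be the set of words of length $j$ whose first letter is $b$ and whose remaining $j-1$ letters lie in $\{0,1,\dots,b-1\}$, and fix subsets $U_j\subseteq W_b(j)$ with $|U_j|=f_0(j)$. For $m\in\mathbb{N}$, let $U_j^m$ be the set of words obtained from words of $U_j$ by replacing the leading letter $b$ by any element of $\{b,b+1,\dots,b+m-1\}$ (so $|U_j^m|=m|U_j|$), and let $\mathscr{U}^m_{b,n}(f_0)$ be the set of words of length $n$ over the alphabet $\{0,1,\dots,b+m-1\}$, starting with the letter $b$, that are concatenations of blocks each belonging to some $U_j^m$, $1\le j\le n$. Define $$f_m(0)=1,\qquad f_m(n)=\sum_{k=1}^{n}\frac{k!}{n!}m^{k-1}B_{n,k}\big(1!f_0(1),2!f_0(2),\dots\big)\quad(n\ge1).$$ Then $f_m(n)=|\mathscr{U}^m_{b,n}(f_0)|$ for all $n\ge1$, and the sequence $(f_m(n))_{n\ge1}$ is the $m$-th iterated invert transform of $f_0$.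
   Context: $B_{n,k}$ denotes the $(n,k)$-th partial Bell polynomial: $B_{n,k}(z_1,\dots,z_{n-k+1})=\sum_{\alpha}\frac{n!}{\alpha_1!\cdots\alpha_{n-k+1}!}\prod_{i}\big(\frac{z_i}{i!}\big)^{\alpha_i}$, summed over $\alpha\in\mathbb{N}_0^{n-k+1}$ with $\sum_i\alpha_i=k$ and $\sum_i i\alpha_i=n$; with an infinite sequence as argument only the first $n-k+1$ entries are used. The invert transform of $(x_n)_{n\ge1}$ is $(y_n)_{n\ge1}$ defined by $1+\sum_{n\ge1}y_nt^n=(1-\sum_{n\ge1}x_nt^n)^{ -1}$; the $m$-th iterated invert transform is its $m$-fold composition. -}

module Defs where

open import Data.Nat as ℕ using (ℕ; zero; suc; _+_; _*_; _∸_; _≤_; _<_; _!)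
open import Data.Nat.Properties using (_≟_; _!≢0; m*n≢0)
open import Data.Integer using (+_)
open import Data.Rational as ℚ using (ℚ; 0ℚ; 1ℚ; _/_)
open import Data.List using (List; []; _∷_; [_]; map; concatMap; upTo; filter; foldr; length; concat)
open import Data.List.Relation.Unary.All using (All)
open import Data.List.Membership.Propositional using (_∈_)
open import Data.Vec using (Vec; []; _∷_)
open import Data.Product using (Σ; _×_; _,_; ∃)
open import Relation.Nullary.Decidable using (_×-dec_)
open import Relation.Binary.PropositionalEquality using (_≡_)

ℕ→ℚ : ℕ → ℚ
ℕ→ℚ n = + n / 1

_^ℚ_ : ℚ → ℕ → ℚ
q ^ℚ zero  = 1ℚ
q ^ℚ suc k = q ℚ.* (q ^ℚ k)

inv! : ℕ → ℚ
inv! i = _/_ (+ 1) (i !) {{i !≢0}}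

sumℚ : List ℚ → ℚ
sumℚ = foldr ℚ._+_ 0ℚ

prodℚ : List ℚ → ℚ
prodℚ = foldr ℚ._*_ 1ℚ

-- Σ_{i = a}^{a + len - 1} f i
sumFrom : ℕ → ℕ → (ℕ → ℚ) → ℚ
sumFrom a zero      f = 0ℚ
sumFrom a (suc len) f = f a ℚ.+ sumFrom (suc a) len f

vecsUpTo : (K L : ℕ) → List (Vec ℕ L)
vecsUpTo K zero    = [ [] ]
vecsUpTo K (suc L) = concatMap (λ a → map (a ∷_) (vecsUpTo K L)) (upTo (suc K))

vsum : ∀ {L} → Vec ℕ L → ℕ
vsum []      = 0
vsum (a ∷ α) = a + vsum α

-- Σ_i i α_i, where the entries of α are indexed starting at i = s
wsumFrom : ∀ {L} → ℕ → Vec ℕ L → ℕ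
wsumFrom s []      = 0
wsumFrom s (a ∷ α) = s * a + wsumFrom (suc s) α

vfactProd : ∀ {L} → Vec ℕ L → ℕ
vfactProd []      = 1
vfactProd (a ∷ α) = a ! * vfactProd α

zProdFrom : ∀ {L} → ℕ → (ℕ → ℚ) → Vec ℕ L → ℚ
zProdFrom s z []      = 1ℚ
zProdFrom s z (a ∷ α) = ((z s ℚ.* inv! s) ^ℚ a) ℚ.* zProdFrom (suc s) z α

bellTerm : ∀ {L} → ℕ → (ℕ → ℚ) → Vec ℕ L → ℚ
bellTerm n z α = (_/_ (+ (n !)) (vfactProd α) {{vfp≢0 α}}) ℚ.* zProdFrom 1 z α
  where
  vfp≢0 : ∀ {L} (α : Vec ℕ L) → ℕ.NonZero (vfactProd α)
  vfp≢0 []      = _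
  vfp≢0 (a ∷ α) = m*n≢0 (a !) (vfactProd α) {{a !≢0}} {{vfp≢0 α}}

-- B_{n,k}(z_1, z_2, …): sum over α ∈ ℕ₀^{n-k+1} with Σ α_i = k and Σ i α_i = n.
-- (Such α have all entries ≤ k, so enumerating entries in {0,…,k} is exhaustive.)
-- The sequence z is indexed from 1 (z 0 is never used).
bell : ℕ → ℕ → (ℕ → ℚ) → ℚ
bell n k z =
  sumℚ (map (bellTerm n z)
    (filter (λ α → (vsum α ≟ k) ×-dec (wsumFrom 1 α ≟ n))
      (vecsUpTo k (n ∸ k + 1))))

fSeq : (m : ℕ) → (f₀ : ℕ → ℕ) → ℕ → ℚ
fSeq m f₀ zero    = 1ℚ
fSeq m f₀ (suc n) =
  sumFrom 1 (suc n) λ k →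
    (ℕ→ℚ (k !) ℚ.* inv! (suc n)) ℚ.* (ℕ→ℚ m ^ℚ (k ∸ 1))
      ℚ.* bell (suc n) k (λ i → ℕ→ℚ (i ! * f₀ i))

-- Invert transform (sequences indexed from 1; value at 0 is ignored)

onePlus : (ℕ → ℚ) → ℕ → ℚ
onePlus y zero    = 1ℚ
onePlus y (suc n) = y (suc n)

oneMinus : (ℕ → ℚ) → ℕ → ℚ
oneMinus x zero    = 1ℚ
oneMinus x (suc n) = ℚ.- x (suc n)

cauchy : (ℕ → ℚ) → (ℕ → ℚ) → ℕ → ℚ
cauchy a c n = sumFrom 0 (suc n) λ i → a i ℚ.* c (n ∸ i)

oneSeries : ℕ → ℚ
oneSeries zero    = 1ℚ
oneSeries (suc n) = 0ℚ

-- y is the invert transform of x:  (1 + Σ y_n tⁿ) · (1 - Σ x_n tⁿ) = 1,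
-- i.e. 1 + Σ y_n tⁿ = (1 - Σ x_n tⁿ)⁻¹ as formal power series
IsInvertTransform : (ℕ → ℚ) → (ℕ → ℚ) → Set
IsInvertTransform x y = ∀ n → cauchy (onePlus y) (oneMinus x) n ≡ oneSeries n

IsIteratedInvert : ℕ → (ℕ → ℚ) → (ℕ → ℚ) → Set
IsIteratedInvert zero    x y = ∀ n → 1 ≤ n → x n ≡ y n
IsIteratedInvert (suc m) x z = Σ (ℕ → ℚ) λ y → IsIteratedInvert m x y × IsInvertTransform y z

Word : Set
Word = List ℕ

InW : ℕ → ℕ → Word → Set
InW b j w = length w ≡ j × Σ Word λ r → w ≡ b ∷ r × All (_< b) r

InUm : ℕ → ℕ → (ℕ → List Word) → ℕ → Word → Set
InUm b m U j w = Σ ℕ λ c → Σ Word λ r →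
  b ≤ c × c < b + m × w ≡ c ∷ r × (b ∷ r) ∈ U j

InScriptU : ℕ → ℕ → (ℕ → List Word) → ℕ → Word → Set
InScriptU b m U n w =
  length w ≡ n × All (_< b + m) w × (Σ Word λ r → w ≡ b ∷ r) ×
  (Σ (List Word) λ blocks →
     All (λ u → Σ ℕ λ j → 1 ≤ j × j ≤ n × InUm b m U j u) blocks × concat blocks ≡ w)

-- Put X = Σ_{j≥1} f₀(j) tʲ and Y_m = Σ_{k≥1} m^(k-1) Xᵏ (formal power series
-- over ℚ).  The proof has three independent parts, joined at the end.
--  * Bell polynomials: for any z, with x_j = z_j/j!, one has
--    (k!/n!)·B_{n,k}(z) = [tⁿ] Xᵏ (bell-as-power), by reading Xᵏ/k! as the
--    yᵏ-coefficient of the product of exponentials ∏_j exp(y x_j tʲ).  Hence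
--    f_m(n) = [tⁿ] Y_m (fSeq-as-Y).
--  * Invert transform: Y_m = X + m·X·Y_m (Y-fixpoint), which forces
--    (1 + Y_{m+1})(1 - Y_m) = 1 (Y-invert); with Y_0 = X this makes f_m the
--    m-th iterated invert transform of f₀.
--  * Words: 𝒰^m_{b,n} is enumerated by an explicit repetition-free list
--    (scriptU) whose length satisfies the same fixpoint equation, because a
--    word splits uniquely into blocks; so it has [tⁿ] Y_m elements.
module Submission where

open import Defs
open import Data.Nat using (ℕ; _≤_; _^_; _∸_)
open import Data.List using (List; length)
open import Data.List.Relation.Unary.All using (All)
open import Data.List.Relation.Unary.Unique.Propositional using (Unique)
open import Data.List.Membership.Propositional using (_∈_)
open import Data.Product using (Σ; _×_)
open import Function.Bundles using (_⇔_)
open import Relation.Binary.PropositionalEquality using (_≡_)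

open import Data.Nat as ℕ using (zero; suc; _<_; z≤n; s≤s; _!)
import Data.Nat.Properties as ℕP
import Data.Integer as ℤ
import Data.Integer.Properties as ℤP
open import Data.Rational as ℚ using (ℚ; 0ℚ; 1ℚ; _+_; _*_; -_; toℚᵘ)
import Data.Rational.Properties as ℚP
open import Data.Rational.Unnormalised as ℚᵘ using (mkℚᵘ; *≡*)
import Data.Rational.Unnormalised.Properties as ℚᵘP
open import Data.Rational.Solver using (module +-*-Solver)
open +-*-Solver using (solve; _:+_; _:*_; :-_; _:=_; con)
open import Relation.Binary.PropositionalEquality
  using (refl; sym; trans; cong; cong₂; subst; subst₂; _≢_; _≗_; module ≡-Reasoning)
open import Data.Empty using (⊥-elim)
open import Data.Sum using (_⊎_; inj₁; inj₂)
open import Relation.Nullary using (Dec; does; yes; no; ¬_)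
open import Relation.Nullary.Decidable using (_×-dec_; does-⇔; dec-false)
open import Data.Nat.Induction using (<-rec)
open import Data.Bool using (true; false; if_then_else_)
open import Data.Product using (_,_; proj₁; proj₂)
open import Function.Bundles using (mk⇔)
open import Data.List using ([]; _∷_; drop; map; concatMap; filter; applyUpTo; upTo; _++_; concat)
import Data.List.Properties as LP
open import Data.Vec using (Vec; []; _∷_)
open import Data.Unit using (⊤; tt)
open import Data.List.Relation.Unary.All as All using ([]; _∷_)
import Data.List.Relation.Unary.All.Properties as AllP
open import Data.List.Relation.Unary.AllPairs using ([]; _∷_)
open import Data.List.Relation.Unary.Any using (here; there)
open import Data.List.Membership.Propositional using (find; lose)
import Data.List.Membership.Propositional.Properties as ∈P
import Data.List.Relation.Unary.Unique.Propositional.Properties as UniqueP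

-- The embedding ℕ → ℚ is a semiring homomorphism, and 1/d is a genuine
-- inverse of d.  Each fact is checked in the unnormalised rationals, into
-- which ℚ embeds injectively.
module NatCast where

  open ℤ using (+_)

  private
    toℚᵘ-/ : ∀ a d → toℚᵘ (+ a ℚ./ suc d) ℚᵘ.≃ mkℚᵘ (+ a) d
    toℚᵘ-/ a d = ℚP.toℚᵘ-fromℚᵘ (mkℚᵘ (+ a) d)

  ℕ→ℚ-homo-+ : ∀ a b → ℕ→ℚ (a ℕ.+ b) ≡ ℕ→ℚ a + ℕ→ℚ b
  ℕ→ℚ-homo-+ a b = ℚP.toℚᵘ-injective (begin
      toℚᵘ (ℕ→ℚ (a ℕ.+ b))            ≈⟨ toℚᵘ-/ (a ℕ.+ b) 0 ⟩
      mkℚᵘ (+ (a ℕ.+ b)) 0             ≈⟨ *≡* cross ⟩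
      mkℚᵘ (+ a) 0 ℚᵘ.+ mkℚᵘ (+ b) 0   ≈⟨ ℚᵘP.+-cong (ℚᵘP.≃-sym (toℚᵘ-/ a 0)) (ℚᵘP.≃-sym (toℚᵘ-/ b 0)) ⟩
      toℚᵘ (ℕ→ℚ a) ℚᵘ.+ toℚᵘ (ℕ→ℚ b)   ≈⟨ ℚᵘP.≃-sym (ℚP.toℚᵘ-homo-+ (ℕ→ℚ a) (ℕ→ℚ b)) ⟩
      toℚᵘ (ℕ→ℚ a + ℕ→ℚ b)             ∎)
    where
    open ℚᵘP.≃-Reasoning
    cross : + (a ℕ.+ b) ℤ.* + 1 ≡ (+ a ℤ.* + 1 ℤ.+ + b ℤ.* + 1) ℤ.* + 1
    cross rewrite ℤP.*-identityʳ (+ (a ℕ.+ b)) | ℤP.*-identityʳ (+ a) | ℤP.*-identityʳ (+ b)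
                | ℤP.*-identityʳ (+ a ℤ.+ + b) = ℤP.pos-+ a b

  ℕ→ℚ-homo-* : ∀ a b → ℕ→ℚ (a ℕ.* b) ≡ ℕ→ℚ a * ℕ→ℚ b
  ℕ→ℚ-homo-* a b = ℚP.toℚᵘ-injective (begin
      toℚᵘ (ℕ→ℚ (a ℕ.* b))            ≈⟨ toℚᵘ-/ (a ℕ.* b) 0 ⟩
      mkℚᵘ (+ (a ℕ.* b)) 0             ≈⟨ *≡* cross ⟩
      mkℚᵘ (+ a) 0 ℚᵘ.* mkℚᵘ (+ b) 0   ≈⟨ ℚᵘP.*-cong (ℚᵘP.≃-sym (toℚᵘ-/ a 0)) (ℚᵘP.≃-sym (toℚᵘ-/ b 0)) ⟩
      toℚᵘ (ℕ→ℚ a) ℚᵘ.* toℚᵘ (ℕ→ℚ b)   ≈⟨ ℚᵘP.≃-sym (ℚP.toℚᵘ-homo-* (ℕ→ℚ a) (ℕ→ℚ b)) ⟩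
      toℚᵘ (ℕ→ℚ a * ℕ→ℚ b)             ∎)
    where
    open ℚᵘP.≃-Reasoning
    cross : + (a ℕ.* b) ℤ.* + 1 ≡ (+ a ℤ.* + b) ℤ.* + 1
    cross rewrite ℤP.*-identityʳ (+ (a ℕ.* b)) | ℤP.*-identityʳ (+ a ℤ.* + b) = ℤP.pos-* a b

  ℕ→ℚ-split-* : ∀ a K c → a ≤ K → ℕ→ℚ K * c ≡ ℕ→ℚ a * c + ℕ→ℚ (K ∸ a) * c
  ℕ→ℚ-split-* a K c a≤K = begin
    ℕ→ℚ K * c                      ≡⟨ cong (λ k → ℕ→ℚ k * c) (sym (ℕP.m+[n∸m]≡n a≤K)) ⟩
    ℕ→ℚ (a ℕ.+ (K ∸ a)) * c        ≡⟨ cong (_* c) (ℕ→ℚ-homo-+ a (K ∸ a)) ⟩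
    (ℕ→ℚ a + ℕ→ℚ (K ∸ a)) * c      ≡⟨ ℚP.*-distribʳ-+ c (ℕ→ℚ a) (ℕ→ℚ (K ∸ a)) ⟩
    ℕ→ℚ a * c + ℕ→ℚ (K ∸ a) * c    ∎
    where open ≡-Reasoning

  1/ℕ : (d : ℕ) → .{{ℕ.NonZero d}} → ℚ
  1/ℕ d = + 1 ℚ./ d

  /-as-* : ∀ a d .{{_ : ℕ.NonZero d}} → + a ℚ./ d ≡ ℕ→ℚ a * 1/ℕ d
  /-as-* a (suc d) = ℚP.toℚᵘ-injective (begin
      toℚᵘ (+ a ℚ./ suc d)                ≈⟨ toℚᵘ-/ a d ⟩
      mkℚᵘ (+ a) d                         ≈⟨ *≡* (sym (ℤP.*-assoc (+ a) (+ 1) (+ suc d))) ⟩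
      mkℚᵘ (+ a) 0 ℚᵘ.* mkℚᵘ (+ 1) d       ≈⟨ ℚᵘP.*-cong (ℚᵘP.≃-sym (toℚᵘ-/ a 0)) (ℚᵘP.≃-sym (toℚᵘ-/ 1 d)) ⟩
      toℚᵘ (ℕ→ℚ a) ℚᵘ.* toℚᵘ (1/ℕ (suc d)) ≈⟨ ℚᵘP.≃-sym (ℚP.toℚᵘ-homo-* (ℕ→ℚ a) (1/ℕ (suc d))) ⟩
      toℚᵘ (ℕ→ℚ a * 1/ℕ (suc d))           ∎)
    where open ℚᵘP.≃-Reasoning

  1/ℕ-homo-* : ∀ a b .{{_ : ℕ.NonZero a}} .{{_ : ℕ.NonZero b}} →
               1/ℕ (a ℕ.* b) {{ℕP.m*n≢0 a b}} ≡ 1/ℕ a * 1/ℕ b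
  1/ℕ-homo-* (suc a) (suc b) = ℚP.toℚᵘ-injective (begin
      toℚᵘ (1/ℕ (suc a ℕ.* suc b))                ≈⟨ toℚᵘ-/ 1 (b ℕ.+ a ℕ.* suc b) ⟩
      mkℚᵘ (+ 1) (b ℕ.+ a ℕ.* suc b)               ≈⟨ *≡* refl ⟩
      mkℚᵘ (+ 1) a ℚᵘ.* mkℚᵘ (+ 1) b               ≈⟨ ℚᵘP.*-cong (ℚᵘP.≃-sym (toℚᵘ-/ 1 a)) (ℚᵘP.≃-sym (toℚᵘ-/ 1 b)) ⟩
      toℚᵘ (1/ℕ (suc a)) ℚᵘ.* toℚᵘ (1/ℕ (suc b))   ≈⟨ ℚᵘP.≃-sym (ℚP.toℚᵘ-homo-* (1/ℕ (suc a)) (1/ℕ (suc b))) ⟩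
      toℚᵘ (1/ℕ (suc a) * 1/ℕ (suc b))             ∎)
    where open ℚᵘP.≃-Reasoning

  ℕ→ℚ-*-1/ℕ : ∀ d .{{_ : ℕ.NonZero d}} → ℕ→ℚ d * 1/ℕ d ≡ 1ℚ
  ℕ→ℚ-*-1/ℕ (suc d) = trans (sym (/-as-* (suc d) (suc d))) (ℚP.toℚᵘ-injective (begin
      toℚᵘ (+ suc d ℚ./ suc d) ≈⟨ toℚᵘ-/ (suc d) d ⟩
      mkℚᵘ (+ suc d) d        ≈⟨ *≡* (ℤP.*-comm (+ suc d) (+ 1)) ⟩
      mkℚᵘ (+ 1) 0            ∎))
    where open ℚᵘP.≃-Reasoning

module FiniteSums where

  open ≡-Reasoning

  sum-shift : ∀ s L f → sumFrom (suc s) L f ≡ sumFrom s L (λ i → f (suc i))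
  sum-shift s zero    f = refl
  sum-shift s (suc L) f = cong (f (suc s) +_) (sum-shift (suc s) L f)

  sum-cong-on : ∀ s L {f g : ℕ → ℚ} → (∀ i → s ≤ i → i < s ℕ.+ L → f i ≡ g i) →
                sumFrom s L f ≡ sumFrom s L g
  sum-cong-on s zero    h = refl
  sum-cong-on s (suc L) h = cong₂ _+_ (h s ℕP.≤-refl (ℕP.m<m+n s (s≤s z≤n)))
    (sum-cong-on (suc s) L λ i s<i i<end → h i (ℕP.≤-trans (ℕP.n≤1+n s) s<i)
       (subst (i <_) (sym (ℕP.+-suc s L)) i<end))

  sum-cong : ∀ s L {f g : ℕ → ℚ} → (∀ i → f i ≡ g i) → sumFrom s L f ≡ sumFrom s L g
  sum-cong s L h = sum-cong-on s L (λ i _ _ → h i)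

  sum-zero-on : ∀ s L {f : ℕ → ℚ} → (∀ i → s ≤ i → i < s ℕ.+ L → f i ≡ 0ℚ) →
                sumFrom s L f ≡ 0ℚ
  sum-zero-on s L {f} h = trans (sum-cong-on s L h) (sum-of-zeros s L)
    where
    sum-of-zeros : ∀ s L → sumFrom s L (λ _ → 0ℚ) ≡ 0ℚ
    sum-of-zeros s zero    = refl
    sum-of-zeros s (suc L) = cong (0ℚ +_) (sum-of-zeros (suc s) L)

  sum-distrib-+ : ∀ s L f g → sumFrom s L (λ i → f i + g i) ≡ sumFrom s L f + sumFrom s L g
  sum-distrib-+ s zero    f g = refl
  sum-distrib-+ s (suc L) f g = begin
    (f s + g s) + sumFrom (suc s) L (λ i → f i + g i)
      ≡⟨ cong ((f s + g s) +_) (sum-distrib-+ (suc s) L f g) ⟩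
    (f s + g s) + (F + G)
      ≡⟨ solve 4 (λ a b c d → (a :+ b) :+ (c :+ d) := (a :+ c) :+ (b :+ d)) refl (f s) (g s) F G ⟩
    (f s + F) + (g s + G) ∎
    where
    F G : ℚ
    F = sumFrom (suc s) L f
    G = sumFrom (suc s) L g

  sum-*ˡ : ∀ s L c f → sumFrom s L (λ i → c * f i) ≡ c * sumFrom s L f
  sum-*ˡ s zero    c f = sym (ℚP.*-zeroʳ c)
  sum-*ˡ s (suc L) c f = begin
    c * f s + sumFrom (suc s) L (λ i → c * f i) ≡⟨ cong (c * f s +_) (sum-*ˡ (suc s) L c f) ⟩
    c * f s + c * sumFrom (suc s) L f            ≡⟨ sym (ℚP.*-distribˡ-+ c (f s) _) ⟩
    c * (f s + sumFrom (suc s) L f)              ∎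

  sum-neg : ∀ s L f → sumFrom s L (λ i → - f i) ≡ - sumFrom s L f
  sum-neg s zero    f = refl
  sum-neg s (suc L) f =
    trans (cong (- f s +_) (sum-neg (suc s) L f)) (sym (ℚP.neg-distrib-+ (f s) _))

  sum-snoc : ∀ s L f → sumFrom s (suc L) f ≡ sumFrom s L f + f (s ℕ.+ L)
  sum-snoc s zero f = begin
    f s + 0ℚ    ≡⟨ ℚP.+-identityʳ (f s) ⟩
    f s         ≡⟨ cong f (sym (ℕP.+-identityʳ s)) ⟩
    f (s ℕ.+ 0) ≡⟨ sym (ℚP.+-identityˡ _) ⟩
    0ℚ + f (s ℕ.+ 0) ∎
  sum-snoc s (suc L) f = begin
    f s + sumFrom (suc s) (suc L) f                ≡⟨ cong (f s +_) (sum-snoc (suc s) L f) ⟩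
    f s + (sumFrom (suc s) L f + f (suc s ℕ.+ L))  ≡⟨ sym (ℚP.+-assoc (f s) _ _) ⟩
    (f s + sumFrom (suc s) L f) + f (suc s ℕ.+ L)  ≡⟨ cong (λ i → (f s + sumFrom (suc s) L f) + f i) (sym (ℕP.+-suc s L)) ⟩
    (f s + sumFrom (suc s) L f) + f (s ℕ.+ suc L)  ∎

  sum-split : ∀ s L M f → sumFrom s (L ℕ.+ M) f ≡ sumFrom s L f + sumFrom (s ℕ.+ L) M f
  sum-split s zero M f =
    trans (cong (λ t → sumFrom t M f) (sym (ℕP.+-identityʳ s))) (sym (ℚP.+-identityˡ _))
  sum-split s (suc L) M f = begin
    f s + sumFrom (suc s) (L ℕ.+ M) f
      ≡⟨ cong (f s +_) (sum-split (suc s) L M f) ⟩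
    f s + (sumFrom (suc s) L f + sumFrom (suc s ℕ.+ L) M f)
      ≡⟨ sym (ℚP.+-assoc (f s) _ _) ⟩
    (f s + sumFrom (suc s) L f) + sumFrom (suc s ℕ.+ L) M f
      ≡⟨ cong (λ t → (f s + sumFrom (suc s) L f) + sumFrom t M f) (sym (ℕP.+-suc s L)) ⟩
    (f s + sumFrom (suc s) L f) + sumFrom (s ℕ.+ suc L) M f ∎

  sum-swap : ∀ a L b M (g : ℕ → ℕ → ℚ) →
    sumFrom a L (λ i → sumFrom b M (g i)) ≡ sumFrom b M (λ j → sumFrom a L (λ i → g i j))
  sum-swap a zero    b M g = sym (sum-zero-on b M (λ _ _ _ → refl))
  sum-swap a (suc L) b M g = begin
    sumFrom b M (g a) + sumFrom (suc a) L (λ i → sumFrom b M (g i))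
      ≡⟨ cong (sumFrom b M (g a) +_) (sum-swap (suc a) L b M g) ⟩
    sumFrom b M (g a) + sumFrom b M (λ j → sumFrom (suc a) L (λ i → g i j))
      ≡⟨ sym (sum-distrib-+ b M (g a) _) ⟩
    sumFrom b M (λ j → g a j + sumFrom (suc a) L (λ i → g i j)) ∎

  sum-reverse : ∀ n f → sumFrom 0 (suc n) f ≡ sumFrom 0 (suc n) (λ i → f (n ∸ i))
  sum-reverse zero    f = refl
  sum-reverse (suc n) f = begin
    sumFrom 0 (suc (suc n)) f                        ≡⟨ sum-snoc 0 (suc n) f ⟩
    sumFrom 0 (suc n) f + f (suc n)                  ≡⟨ cong (_+ f (suc n)) (sum-reverse n f) ⟩
    sumFrom 0 (suc n) (λ i → f (n ∸ i)) + f (suc n)  ≡⟨ ℚP.+-comm _ (f (suc n)) ⟩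
    f (suc n) + sumFrom 0 (suc n) (λ i → f (n ∸ i))
      ≡⟨ cong (f (suc n) +_) (sym (sum-shift 0 (suc n) (λ i → f (suc n ∸ i)))) ⟩
    f (suc n) + sumFrom 1 (suc n) (λ i → f (suc n ∸ i)) ∎

module PowerSeries where

  open ≡-Reasoning
  open FiniteSums

  Series : Set
  Series = ℕ → ℚ

  infixl 7 _⊛_ _·_
  infixl 6 _⊕_

  _⊛_ : Series → Series → Series
  a ⊛ c = cauchy a c

  _⊕_ : Series → Series → Series
  (a ⊕ c) n = a n + c n

  _·_ : ℚ → Series → Series
  (k · a) n = k * a n

  ⊖_ : Series → Series
  (⊖ a) n = - a n

  0ₛ : Series
  0ₛ _ = 0ℚ

  ⊛-suc : ∀ a c n → (a ⊛ c) (suc n) ≡ a 0 * c (suc n) + ((λ i → a (suc i)) ⊛ c) n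
  ⊛-suc a c n = cong (a 0 * c (suc n) +_) (sum-shift 0 (suc n) (λ i → a i * c (suc n ∸ i)))

  ⊛-congˡ : ∀ {a a'} c → a ≗ a' → a ⊛ c ≗ a' ⊛ c
  ⊛-congˡ c a≗a' n = sum-cong 0 (suc n) (λ i → cong (_* c (n ∸ i)) (a≗a' i))

  ⊛-congʳ : ∀ a {c c'} → c ≗ c' → a ⊛ c ≗ a ⊛ c'
  ⊛-congʳ a c≗c' n = sum-cong 0 (suc n) (λ i → cong (a i *_) (c≗c' (n ∸ i)))

  ⊛-distribʳ-⊕ : ∀ a b c → (a ⊕ b) ⊛ c ≗ a ⊛ c ⊕ b ⊛ c
  ⊛-distribʳ-⊕ a b c n =
    trans (sum-cong 0 (suc n) (λ i → ℚP.*-distribʳ-+ (c (n ∸ i)) (a i) (b i)))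
          (sum-distrib-+ 0 (suc n) (λ i → a i * c (n ∸ i)) (λ i → b i * c (n ∸ i)))

  ⊛-distribˡ-⊕ : ∀ a b c → a ⊛ (b ⊕ c) ≗ a ⊛ b ⊕ a ⊛ c
  ⊛-distribˡ-⊕ a b c n =
    trans (sum-cong 0 (suc n) (λ i → ℚP.*-distribˡ-+ (a i) (b (n ∸ i)) (c (n ∸ i))))
          (sum-distrib-+ 0 (suc n) (λ i → a i * b (n ∸ i)) (λ i → a i * c (n ∸ i)))

  ⊛-·ˡ : ∀ k a c → (k · a) ⊛ c ≗ k · (a ⊛ c)
  ⊛-·ˡ k a c n = trans (sum-cong 0 (suc n) (λ i → ℚP.*-assoc k (a i) (c (n ∸ i))))
                       (sum-*ˡ 0 (suc n) k (λ i → a i * c (n ∸ i)))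

  ⊛-·ʳ : ∀ k a c → a ⊛ (k · c) ≗ k · (a ⊛ c)
  ⊛-·ʳ k a c n =
    trans (sum-cong 0 (suc n) (λ i → solve 3 (λ x y z → x :* (y :* z) := y :* (x :* z)) refl (a i) k (c (n ∸ i))))
          (sum-*ˡ 0 (suc n) k (λ i → a i * c (n ∸ i)))

  ⊛-⊖ʳ : ∀ a c → a ⊛ (⊖ c) ≗ ⊖ (a ⊛ c)
  ⊛-⊖ʳ a c n = trans (sum-cong 0 (suc n) (λ i → sym (ℚP.neg-distribʳ-* (a i) (c (n ∸ i)))))
                     (sum-neg 0 (suc n) (λ i → a i * c (n ∸ i)))

  ⊛-zeroˡ : ∀ c → 0ₛ ⊛ c ≗ 0ₛ
  ⊛-zeroˡ c n = sum-zero-on 0 (suc n) (λ i _ _ → ℚP.*-zeroˡ (c (n ∸ i)))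

  ⊛-zeroʳ : ∀ a → a ⊛ 0ₛ ≗ 0ₛ
  ⊛-zeroʳ a n = sum-zero-on 0 (suc n) (λ i _ _ → ℚP.*-zeroʳ (a i))

  ⊛-sumʳ : ∀ s L a (C : ℕ → Series) →
           a ⊛ (λ i → sumFrom s L (λ j → C j i)) ≗ (λ n → sumFrom s L (λ j → (a ⊛ C j) n))
  ⊛-sumʳ s L a C n =
    trans (sum-cong 0 (suc n) (λ i → sym (sum-*ˡ s L (a i) (λ j → C j (n ∸ i)))))
          (sum-swap 0 (suc n) s L (λ i j → a i * C j (n ∸ i)))

  ⊛-assoc : ∀ a b c → (a ⊛ b) ⊛ c ≗ a ⊛ (b ⊛ c)
  ⊛-assoc a b c zero = solve 3 (λ x y z → (x :* y :+ con 0ℚ) :* z :+ con 0ℚ := x :* (y :* z :+ con 0ℚ) :+ con 0ℚ)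
                               refl (a 0) (b 0) (c 0)
  ⊛-assoc a b c (suc n) = begin
    ((a ⊛ b) ⊛ c) (suc n)
      ≡⟨ ⊛-suc (a ⊛ b) c n ⟩
    (a ⊛ b) 0 * c (suc n) + ((λ i → (a ⊛ b) (suc i)) ⊛ c) n
      ≡⟨ cong ((a ⊛ b) 0 * c (suc n) +_) (⊛-congˡ c (⊛-suc a b) n) ⟩
    (a ⊛ b) 0 * c (suc n) + (((a 0 · b₊) ⊕ (a₊ ⊛ b)) ⊛ c) n
      ≡⟨ cong ((a ⊛ b) 0 * c (suc n) +_) (⊛-distribʳ-⊕ (a 0 · b₊) (a₊ ⊛ b) c n) ⟩
    (a ⊛ b) 0 * c (suc n) + (((a 0 · b₊) ⊛ c) n + ((a₊ ⊛ b) ⊛ c) n)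
      ≡⟨ cong₂ (λ u v → (a ⊛ b) 0 * c (suc n) + (u + v)) (⊛-·ˡ (a 0) b₊ c n) (⊛-assoc a₊ b c n) ⟩
    (a 0 * b 0 + 0ℚ) * c (suc n) + (a 0 * (b₊ ⊛ c) n + rest)
      ≡⟨ solve 5 (λ a₀ b₀ c₁ y x → (a₀ :* b₀ :+ con 0ℚ) :* c₁ :+ (a₀ :* y :+ x) := a₀ :* (b₀ :* c₁ :+ y) :+ x)
               refl (a 0) (b 0) (c (suc n)) ((b₊ ⊛ c) n) rest ⟩
    a 0 * (b 0 * c (suc n) + (b₊ ⊛ c) n) + rest
      ≡⟨ cong (λ u → a 0 * u + rest) (sym (⊛-suc b c n)) ⟩
    a 0 * (b ⊛ c) (suc n) + rest
      ≡⟨ sym (⊛-suc a (b ⊛ c) n) ⟩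
    (a ⊛ (b ⊛ c)) (suc n) ∎
    where
    a₊ b₊ : Series
    a₊ i = a (suc i)
    b₊ i = b (suc i)
    rest : ℚ
    rest = (a₊ ⊛ (b ⊛ c)) n

  ⊛-comm : ∀ a c → a ⊛ c ≗ c ⊛ a
  ⊛-comm a c n = begin
    sumFrom 0 (suc n) (λ i → a i * c (n ∸ i))
      ≡⟨ sum-reverse n (λ i → a i * c (n ∸ i)) ⟩
    sumFrom 0 (suc n) (λ i → a (n ∸ i) * c (n ∸ (n ∸ i)))
      ≡⟨ sum-cong-on 0 (suc n) (λ i _ i≤n → trans (cong (λ j → a (n ∸ i) * c j) (ℕP.m∸[m∸n]≡n (ℕP.≤-pred i≤n)))
                                                   (ℚP.*-comm (a (n ∸ i)) (c i))) ⟩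
    sumFrom 0 (suc n) (λ i → c i * a (n ∸ i)) ∎

  monomial : ℕ → ℚ → Series
  monomial zero    c zero    = c
  monomial zero    c (suc n) = 0ℚ
  monomial (suc d) c zero    = 0ℚ
  monomial (suc d) c (suc n) = monomial d c n

  one : Series
  one = monomial 0 1ℚ

  monomial-self : ∀ d c → monomial d c d ≡ c
  monomial-self zero    c = refl
  monomial-self (suc d) c = monomial-self d c

  monomial-other : ∀ d c i → i ≢ d → monomial d c i ≡ 0ℚ
  monomial-other zero    c zero    i≢d = ⊥-elim (i≢d refl)
  monomial-other zero    c (suc i) i≢d = refl
  monomial-other (suc d) c zero    i≢d = refl
  monomial-other (suc d) c (suc i) i≢d = monomial-other d c i (λ i≡d → i≢d (cong suc i≡d))

  monomial-· : ∀ d k c → monomial d (k * c) ≗ k · monomial d c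
  monomial-· zero    k c zero    = refl
  monomial-· zero    k c (suc i) = sym (ℚP.*-zeroʳ k)
  monomial-· (suc d) k c zero    = sym (ℚP.*-zeroʳ k)
  monomial-· (suc d) k c (suc i) = monomial-· d k c i

  ⊛-monomial₀ : ∀ c A → monomial 0 c ⊛ A ≗ c · A
  ⊛-monomial₀ c A zero    = ℚP.+-identityʳ (c * A 0)
  ⊛-monomial₀ c A (suc n) = begin
    (monomial 0 c ⊛ A) (suc n)  ≡⟨ ⊛-suc (monomial 0 c) A n ⟩
    c * A (suc n) + (0ₛ ⊛ A) n  ≡⟨ cong (c * A (suc n) +_) (⊛-zeroˡ A n) ⟩
    c * A (suc n) + 0ℚ          ≡⟨ ℚP.+-identityʳ _ ⟩
    c * A (suc n)               ∎

  one-⊛ : ∀ A → one ⊛ A ≗ A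
  one-⊛ A n = trans (⊛-monomial₀ 1ℚ A n) (ℚP.*-identityˡ (A n))

  private
    ⊛-monomial-zero : ∀ d c A → (monomial (suc d) c ⊛ A) 0 ≡ 0ℚ
    ⊛-monomial-zero d c A = trans (ℚP.+-identityʳ (0ℚ * A 0)) (ℚP.*-zeroˡ (A 0))

    ⊛-monomial-suc : ∀ d c A n → (monomial (suc d) c ⊛ A) (suc n) ≡ (monomial d c ⊛ A) n
    ⊛-monomial-suc d c A n = begin
      (monomial (suc d) c ⊛ A) (suc n)        ≡⟨ ⊛-suc (monomial (suc d) c) A n ⟩
      0ℚ * A (suc n) + (monomial d c ⊛ A) n  ≡⟨ cong (_+ (monomial d c ⊛ A) n) (ℚP.*-zeroˡ (A (suc n))) ⟩
      0ℚ + (monomial d c ⊛ A) n              ≡⟨ ℚP.+-identityˡ _ ⟩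
      (monomial d c ⊛ A) n                   ∎

  ⊛-monomial-≤ : ∀ d c A n → d ≤ n → (monomial d c ⊛ A) n ≡ c * A (n ∸ d)
  ⊛-monomial-≤ zero    c A n       _         = ⊛-monomial₀ c A n
  ⊛-monomial-≤ (suc d) c A (suc n) (s≤s d≤n) =
    trans (⊛-monomial-suc d c A n) (⊛-monomial-≤ d c A n d≤n)

  ⊛-monomial-> : ∀ d c A n → n < d → (monomial d c ⊛ A) n ≡ 0ℚ
  ⊛-monomial-> (suc d) c A zero    _         = ⊛-monomial-zero d c A
  ⊛-monomial-> (suc d) c A (suc n) (s≤s n<d) =
    trans (⊛-monomial-suc d c A n) (⊛-monomial-> d c A n n<d)

  monomial-⊛ : ∀ d e c c' A → monomial (d ℕ.+ e) (c * c') ⊛ A ≗ monomial d c ⊛ (monomial e c' ⊛ A)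
  monomial-⊛ zero e c c' A n = begin
    (monomial e (c * c') ⊛ A) n     ≡⟨ ⊛-congˡ A (monomial-· e c c') n ⟩
    ((c · monomial e c') ⊛ A) n     ≡⟨ ⊛-·ˡ c (monomial e c') A n ⟩
    c * (monomial e c' ⊛ A) n       ≡⟨ sym (⊛-monomial₀ c (monomial e c' ⊛ A) n) ⟩
    (monomial 0 c ⊛ (monomial e c' ⊛ A)) n ∎
  monomial-⊛ (suc d) e c c' A zero =
    trans (⊛-monomial-zero (d ℕ.+ e) (c * c') A) (sym (⊛-monomial-zero d c (monomial e c' ⊛ A)))
  monomial-⊛ (suc d) e c c' A (suc n) =
    trans (⊛-monomial-suc (d ℕ.+ e) (c * c') A n)
      (trans (monomial-⊛ d e c c' A n) (sym (⊛-monomial-suc d c (monomial e c' ⊛ A) n)))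

module ListSums where

  open ≡-Reasoning
  open NatCast using (ℕ→ℚ-homo-+)

  sumℚ-++ : ∀ {A : Set} (g : A → ℚ) xs ys →
            sumℚ (map g (xs ++ ys)) ≡ sumℚ (map g xs) + sumℚ (map g ys)
  sumℚ-++ g []       ys = sym (ℚP.+-identityˡ _)
  sumℚ-++ g (x ∷ xs) ys =
    trans (cong (g x +_) (sumℚ-++ g xs ys)) (sym (ℚP.+-assoc (g x) _ _))

  sumℚ-concatMap : ∀ {A B : Set} (g : B → ℚ) (h : A → List B) xs →
    sumℚ (map g (concatMap h xs)) ≡ sumℚ (map (λ x → sumℚ (map g (h x))) xs)
  sumℚ-concatMap g h []       = refl
  sumℚ-concatMap g h (x ∷ xs) =
    trans (sumℚ-++ g (h x) (concatMap h xs)) (cong (sumℚ (map g (h x)) +_) (sumℚ-concatMap g h xs))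

  sumℚ-*ˡ : ∀ {A : Set} c (g : A → ℚ) xs → sumℚ (map (λ x → c * g x) xs) ≡ c * sumℚ (map g xs)
  sumℚ-*ˡ c g []       = sym (ℚP.*-zeroʳ c)
  sumℚ-*ˡ c g (x ∷ xs) =
    trans (cong (c * g x +_) (sumℚ-*ˡ c g xs)) (sym (ℚP.*-distribˡ-+ c (g x) _))

  sumℚ-zero : ∀ {A : Set} {g : A → ℚ} xs → (∀ x → g x ≡ 0ℚ) → sumℚ (map g xs) ≡ 0ℚ
  sumℚ-zero []       g≡0 = refl
  sumℚ-zero (x ∷ xs) g≡0 = cong₂ _+_ (g≡0 x) (sumℚ-zero xs g≡0)

  sumℚ-applyUpTo : ∀ (h : ℕ → ℚ) f n → sumℚ (map h (applyUpTo f n)) ≡ sumFrom 0 n (λ i → h (f i))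
  sumℚ-applyUpTo h f zero    = refl
  sumℚ-applyUpTo h f (suc n) = cong (h (f 0) +_) (trans (sumℚ-applyUpTo h (λ i → f (suc i)) n)
                                                        (sym (FiniteSums.sum-shift 0 n (λ i → h (f i)))))

  sumℚ-filter : ∀ {A : Set} {P : A → Set} (P? : ∀ x → Dec (P x)) (g : A → ℚ) xs →
    sumℚ (map g (filter P? xs)) ≡ sumℚ (map (λ x → if does (P? x) then g x else 0ℚ) xs)
  sumℚ-filter P? g []       = refl
  sumℚ-filter P? g (x ∷ xs) with does (P? x)
  ... | true  = cong (g x +_) (sumℚ-filter P? g xs)
  ... | false = trans (sumℚ-filter P? g xs) (sym (ℚP.+-identityˡ _))

  sumℚ-const : ∀ {A : Set} (c : ℚ) (xs : List A) → sumℚ (map (λ _ → c) xs) ≡ ℕ→ℚ (length xs) * c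
  sumℚ-const c []       = sym (ℚP.*-zeroˡ c)
  sumℚ-const c (x ∷ xs) = begin
    c + sumℚ (map (λ _ → c) xs)        ≡⟨ cong (c +_) (sumℚ-const c xs) ⟩
    c + ℕ→ℚ (length xs) * c            ≡⟨ cong (_+ ℕ→ℚ (length xs) * c) (sym (ℚP.*-identityˡ c)) ⟩
    1ℚ * c + ℕ→ℚ (length xs) * c       ≡⟨ sym (ℚP.*-distribʳ-+ c 1ℚ (ℕ→ℚ (length xs))) ⟩
    (1ℚ + ℕ→ℚ (length xs)) * c         ≡⟨ cong (_* c) (sym (ℕ→ℚ-homo-+ 1 (length xs))) ⟩
    ℕ→ℚ (suc (length xs)) * c          ∎

  length-concatMap : ∀ {A B : Set} (h : A → List B) xs →
    ℕ→ℚ (length (concatMap h xs)) ≡ sumℚ (map (λ x → ℕ→ℚ (length (h x))) xs)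
  length-concatMap h []       = refl
  length-concatMap h (x ∷ xs) = begin
    ℕ→ℚ (length (h x ++ concatMap h xs))
      ≡⟨ cong ℕ→ℚ (LP.length-++ (h x)) ⟩
    ℕ→ℚ (length (h x) ℕ.+ length (concatMap h xs))
      ≡⟨ ℕ→ℚ-homo-+ (length (h x)) _ ⟩
    ℕ→ℚ (length (h x)) + ℕ→ℚ (length (concatMap h xs))
      ≡⟨ cong (ℕ→ℚ (length (h x)) +_) (length-concatMap h xs) ⟩
    ℕ→ℚ (length (h x)) + sumℚ (map (λ x → ℕ→ℚ (length (h x))) xs) ∎

∸-<-∸ : ∀ {n m i j} → n < m → i ≤ n → j ≤ i → n ∸ i < m ∸ j
∸-<-∸ {n} {m} {i} {j} n<m i≤n j≤i = ℕP.<-≤-trans (ℕP.∸-monoˡ-< n<m i≤n) (ℕP.∸-monoʳ-≤ m j≤i)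

module Powers (x : ℕ → ℚ) where

  open ≡-Reasoning
  open FiniteSums
  open PowerSeries

  X : Series
  X zero    = 0ℚ
  X (suc n) = x (suc n)

  X^ : ℕ → Series
  X^ zero    = one
  X^ (suc k) = X ⊛ X^ k

  X^1 : X^ 1 ≗ X
  X^1 n = trans (⊛-comm X one n) (one-⊛ X n)

  -- as X has no constant term, [tⁿ](X ⊛ D) only involves coefficients of D below tⁿ
  X⊛-zero-below : ∀ D n → (∀ i → i < n → D i ≡ 0ℚ) → (X ⊛ D) n ≡ 0ℚ
  X⊛-zero-below D n D≡0 = sum-zero-on 0 (suc n) term
    where
    term : ∀ i → 0 ≤ i → i < suc n → X i * D (n ∸ i) ≡ 0ℚ
    term zero    _ _    = ℚP.*-zeroˡ (D n)
    term (suc i) _ i≤n  = trans (cong (X (suc i) *_) (D≡0 (n ∸ suc i) (∸-<-∸ (ℕP.n<1+n n) (ℕP.≤-pred i≤n) (s≤s z≤n))))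
                                (ℚP.*-zeroʳ (X (suc i)))

  X^-vanish : ∀ k n → n < k → X^ k n ≡ 0ℚ
  X^-vanish (suc k) n n<k = X⊛-zero-below (X^ k) n
    (λ i i<n → X^-vanish k i (ℕP.<-≤-trans i<n (ℕP.≤-pred n<k)))

  X-contraction : ∀ c D → D ≗ c · (X ⊛ D) → D ≗ 0ₛ
  X-contraction c D fix = <-rec (λ n → D n ≡ 0ℚ) λ n below →
      trans (fix n) (trans (cong (c *_) (X⊛-zero-below D n (λ i i<n → below i<n))) (ℚP.*-zeroʳ c))

X^-cong : ∀ {x x' : ℕ → ℚ} → (∀ j → x (suc j) ≡ x' (suc j)) → ∀ k → Powers.X^ x k ≗ Powers.X^ x' k
X^-cong         h zero    n = refl
X^-cong {x} {x'} h (suc k) n =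
  trans (PowerSeries.⊛-congˡ (Powers.X^ x k) X≗X' n) (PowerSeries.⊛-congʳ (Powers.X x') (X^-cong h k) n)
  where
  X≗X' : Powers.X x ≗ Powers.X x'
  X≗X' zero    = refl
  X≗X' (suc j) = h j

-- Xᵏ/k! is the coefficient of yᵏ in exp(y·X) = ∏_{j≥1} exp(y x_j tʲ).  We name
-- the coefficient of yᵏ in a finite partial product (expProduct), show that
-- k!·expProduct agrees with Xᵏ using ∂_y exp(y·X) = X·exp(y·X), and then
-- expand the product into the sum over exponent vectors α defining B_{n,k}.
module BellCoefficients (z : ℕ → ℚ) where

  open ≡-Reasoning
  open FiniteSums
  open PowerSeries
  open NatCast
  open ListSums

  x : ℕ → ℚ
  x j = z j * inv! j

  open Powers x

  -- [yᵃ] exp(y·x_s) = x_sᵃ/a!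
  expCoeff : ℕ → ℕ → ℚ
  expCoeff s a = (x s ^ℚ a) * inv! a

  -- [yᵏ] ∏_{j=s}^{s+L-1} exp(y x_j tʲ), a series in t
  expProduct : ℕ → ℕ → ℕ → Series
  expProduct s zero    zero    = one
  expProduct s zero    (suc k) = 0ₛ
  expProduct s (suc L) k n     =
    sumFrom 0 (suc k) (λ a → (monomial (s ℕ.* a) (expCoeff s a) ⊛ expProduct (suc s) L (k ∸ a)) n)

  truncX : ℕ → ℕ → Series
  truncX s L n = sumFrom s L (λ j → monomial j (x j) n)

  truncX-outside : ∀ s L i → i < s ⊎ s ℕ.+ L ≤ i → truncX s L i ≡ 0ℚ
  truncX-outside s L i i∉ = sum-zero-on s L (λ j s≤j j<s+L → monomial-other j (x j) i (i≢j j s≤j j<s+L i∉))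
    where
    i≢j : ∀ j → s ≤ j → j < s ℕ.+ L → i < s ⊎ s ℕ.+ L ≤ i → i ≢ j
    i≢j j s≤j j<s+L (inj₁ i<s)   refl = ℕP.<⇒≱ i<s s≤j
    i≢j j s≤j j<s+L (inj₂ s+L≤i) refl = ℕP.<⇒≱ j<s+L s+L≤i

  truncX-inside : ∀ s L i → s ≤ i → i < s ℕ.+ L → truncX s L i ≡ x i
  truncX-inside s zero    i s≤i i<s+0 = ⊥-elim (ℕP.<⇒≱ (subst (i <_) (ℕP.+-identityʳ s) i<s+0) s≤i)
  truncX-inside s (suc L) i s≤i i<s+L with s ℕ.≟ i
  ... | yes refl = begin
    monomial s (x s) s + truncX (suc s) L s
      ≡⟨ cong₂ _+_ (monomial-self s (x s)) (truncX-outside (suc s) L s (inj₁ (ℕP.n<1+n s))) ⟩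
    x s + 0ℚ ≡⟨ ℚP.+-identityʳ _ ⟩
    x s      ∎
  ... | no s≢i = begin
    monomial s (x s) i + truncX (suc s) L i
      ≡⟨ cong₂ _+_ (monomial-other s (x s) i (λ i≡s → s≢i (sym i≡s)))
                   (truncX-inside (suc s) L i (ℕP.≤∧≢⇒< s≤i s≢i) (subst (i <_) (ℕP.+-suc s L) i<s+L)) ⟩
    0ℚ + x i ≡⟨ ℚP.+-identityˡ _ ⟩
    x i      ∎

  -- ∂_y exp(y·x_s) = x_s·exp(y·x_s), coefficientwise
  expCoeff-suc : ∀ s a → ℕ→ℚ (suc a) * expCoeff s (suc a) ≡ x s * expCoeff s a
  expCoeff-suc s a = begin
    N * ((x s * p) * 1/ℕ (suc a ℕ.* a !) {{ℕP.m*n≢0 (suc a) (a !) {{_}} {{a ℕP.!≢0}}}})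
      ≡⟨ cong (λ q → N * ((x s * p) * q)) (1/ℕ-homo-* (suc a) (a !) {{_}} {{a ℕP.!≢0}}) ⟩
    N * ((x s * p) * (r * q))
      ≡⟨ solve 5 (λ N x p r q → N :* ((x :* p) :* (r :* q)) := (N :* r) :* (x :* (p :* q))) refl N (x s) p r q ⟩
    (N * r) * (x s * (p * q)) ≡⟨ cong (_* (x s * (p * q))) (ℕ→ℚ-*-1/ℕ (suc a)) ⟩
    1ℚ * (x s * (p * q))      ≡⟨ ℚP.*-identityˡ _ ⟩
    x s * (p * q)             ∎
    where
    N p r q : ℚ
    N = ℕ→ℚ (suc a)
    p = x s ^ℚ a
    r = 1/ℕ (suc a)
    q = 1/ℕ (a !) {{a ℕP.!≢0}}

  -- the same for the factor exp(y x_s tˢ), acting on an arbitrary series T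
  expFactor-derivative : ∀ s a T n →
    ℕ→ℚ (suc a) * (monomial (s ℕ.* suc a) (expCoeff s (suc a)) ⊛ T) n
      ≡ (monomial s (x s) ⊛ (monomial (s ℕ.* a) (expCoeff s a) ⊛ T)) n
  expFactor-derivative s a T n = begin
    N * (monomial (s ℕ.* suc a) (expCoeff s (suc a)) ⊛ T) n
      ≡⟨ sym (⊛-·ˡ N (monomial (s ℕ.* suc a) (expCoeff s (suc a))) T n) ⟩
    ((N · monomial (s ℕ.* suc a) (expCoeff s (suc a))) ⊛ T) n
      ≡⟨ sym (⊛-congˡ T (monomial-· (s ℕ.* suc a) N (expCoeff s (suc a))) n) ⟩
    (monomial (s ℕ.* suc a) (N * expCoeff s (suc a)) ⊛ T) n
      ≡⟨ cong₂ (λ d c → (monomial d c ⊛ T) n) (ℕP.*-suc s a) (expCoeff-suc s a) ⟩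
    (monomial (s ℕ.+ s ℕ.* a) (x s * expCoeff s a) ⊛ T) n
      ≡⟨ monomial-⊛ s (s ℕ.* a) (x s) (expCoeff s a) T n ⟩
    (monomial s (x s) ⊛ (monomial (s ℕ.* a) (expCoeff s a) ⊛ T)) n ∎
    where
    N : ℚ
    N = ℕ→ℚ (suc a)

  -- the part of ∂_y expProduct s (L+1) where the derivative hits the first factor
  differentiate-first : ∀ s L k n →
    sumFrom 0 (suc (suc k)) (λ a → ℕ→ℚ a * (monomial (s ℕ.* a) (expCoeff s a) ⊛ expProduct (suc s) L (suc k ∸ a)) n)
      ≡ (monomial s (x s) ⊛ expProduct s (suc L) k) n
  differentiate-first s L k n = begin
    ℕ→ℚ 0 * c 0 (suc k) + sumFrom 1 (suc k) (λ a → ℕ→ℚ a * c a (suc k ∸ a))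
      ≡⟨ cong₂ _+_ (ℚP.*-zeroˡ (c 0 (suc k))) (sum-shift 0 (suc k) (λ a → ℕ→ℚ a * c a (suc k ∸ a))) ⟩
    0ℚ + sumFrom 0 (suc k) (λ a → ℕ→ℚ (suc a) * c (suc a) (k ∸ a))
      ≡⟨ ℚP.+-identityˡ _ ⟩
    sumFrom 0 (suc k) (λ a → ℕ→ℚ (suc a) * c (suc a) (k ∸ a))
      ≡⟨ sum-cong 0 (suc k) (λ a → expFactor-derivative s a (expProduct (suc s) L (k ∸ a)) n) ⟩
    sumFrom 0 (suc k) (λ a → (xₛtˢ ⊛ term a) n)
      ≡⟨ sym (⊛-sumʳ 0 (suc k) xₛtˢ term n) ⟩
    (xₛtˢ ⊛ expProduct s (suc L) k) n ∎
    where
    c : ℕ → ℕ → ℚ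
    c a j = (monomial (s ℕ.* a) (expCoeff s a) ⊛ expProduct (suc s) L j) n
    xₛtˢ : Series
    xₛtˢ = monomial s (x s)
    term : ℕ → Series
    term a = monomial (s ℕ.* a) (expCoeff s a) ⊛ expProduct (suc s) L (k ∸ a)

  -- ∂_y of the partial product: (k+1)·[y^(k+1)] = truncX ⊛ [yᵏ]
  expProduct-derivative : ∀ L s k → ℕ→ℚ (suc k) · expProduct s L (suc k) ≗ truncX s L ⊛ expProduct s L k
  expProduct-derivative zero    s k n = trans (ℚP.*-zeroʳ (ℕ→ℚ (suc k))) (sym (⊛-zeroˡ (expProduct s zero k) n))
  expProduct-derivative (suc L) s k n = begin
    ℕ→ℚ K * sumFrom 0 (suc K) (λ a → c a (K ∸ a))
      ≡⟨ sym (sum-*ˡ 0 (suc K) (ℕ→ℚ K) (λ a → c a (K ∸ a))) ⟩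
    sumFrom 0 (suc K) (λ a → ℕ→ℚ K * c a (K ∸ a))
      ≡⟨ sum-cong-on 0 (suc K) (λ a _ a≤K → split-weight a (ℕP.≤-pred a≤K)) ⟩
    sumFrom 0 (suc K) (λ a → ℕ→ℚ a * c a (K ∸ a) + B a)
      ≡⟨ sum-distrib-+ 0 (suc K) (λ a → ℕ→ℚ a * c a (K ∸ a)) B ⟩
    sumFrom 0 (suc K) (λ a → ℕ→ℚ a * c a (K ∸ a)) + sumFrom 0 (suc K) B
      ≡⟨ cong₂ _+_ (differentiate-first s L k n) differentiate-rest ⟩
    (monomial s (x s) ⊛ expProduct s (suc L) k) n + (truncX (suc s) L ⊛ expProduct s (suc L) k) n
      ≡⟨ sym (⊛-distribʳ-⊕ (monomial s (x s)) (truncX (suc s) L) (expProduct s (suc L) k) n) ⟩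
    (truncX s (suc L) ⊛ expProduct s (suc L) k) n ∎
    where
    K : ℕ
    K = suc k
    P' : ℕ → Series
    P' = expProduct (suc s) L
    R' : Series
    R' = truncX (suc s) L
    M : ℕ → Series
    M a = monomial (s ℕ.* a) (expCoeff s a)
    c : ℕ → ℕ → ℚ
    c a j = (M a ⊛ P' j) n
    -- the terms where ∂_y hits the remaining factors
    B : ℕ → ℚ
    B a = (M a ⊛ (ℕ→ℚ (K ∸ a) · P' (K ∸ a))) n

    -- K = a + (K - a) splits the weight between the first and the other factors
    split-weight : ∀ a → a ≤ K → ℕ→ℚ K * c a (K ∸ a) ≡ ℕ→ℚ a * c a (K ∸ a) + B a
    split-weight a a≤K =
      trans (ℕ→ℚ-split-* a K (c a (K ∸ a)) a≤K)
            (cong (ℕ→ℚ a * c a (K ∸ a) +_) (sym (⊛-·ʳ (ℕ→ℚ (K ∸ a)) (M a) (P' (K ∸ a)) n)))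

    rest-term : ∀ a → a ≤ k → B a ≡ (R' ⊛ (M a ⊛ P' (k ∸ a))) n
    rest-term a a≤k = begin
      B a
        ≡⟨ cong (λ j → (M a ⊛ (ℕ→ℚ j · P' j)) n) (ℕP.+-∸-assoc 1 a≤k) ⟩
      (M a ⊛ (ℕ→ℚ (suc (k ∸ a)) · P' (suc (k ∸ a)))) n
        ≡⟨ ⊛-congʳ (M a) (expProduct-derivative L (suc s) (k ∸ a)) n ⟩
      (M a ⊛ (R' ⊛ P' (k ∸ a))) n             ≡⟨ sym (⊛-assoc (M a) R' (P' (k ∸ a)) n) ⟩
      ((M a ⊛ R') ⊛ P' (k ∸ a)) n             ≡⟨ ⊛-congˡ (P' (k ∸ a)) (⊛-comm (M a) R') n ⟩
      ((R' ⊛ M a) ⊛ P' (k ∸ a)) n             ≡⟨ ⊛-assoc R' (M a) (P' (k ∸ a)) n ⟩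
      (R' ⊛ (M a ⊛ P' (k ∸ a))) n             ∎

    differentiate-rest : sumFrom 0 (suc K) B ≡ (R' ⊛ expProduct s (suc L) k) n
    differentiate-rest = begin
      sumFrom 0 (suc K) B      ≡⟨ sum-snoc 0 K B ⟩
      sumFrom 0 K B + B K      ≡⟨ cong (sumFrom 0 K B +_) last-vanishes ⟩
      sumFrom 0 K B + 0ℚ       ≡⟨ ℚP.+-identityʳ _ ⟩
      sumFrom 0 K B            ≡⟨ sum-cong-on 0 K (λ a _ a<K → rest-term a (ℕP.≤-pred a<K)) ⟩
      sumFrom 0 K (λ a → (R' ⊛ (M a ⊛ P' (k ∸ a))) n)
        ≡⟨ sym (⊛-sumʳ 0 K R' (λ a → M a ⊛ P' (k ∸ a)) n) ⟩
      (R' ⊛ expProduct s (suc L) k) n ∎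
      where
      last-vanishes : B K ≡ 0ℚ
      last-vanishes = begin
        B K ≡⟨ ⊛-congʳ (M K) (λ i → trans (cong (λ j → ℕ→ℚ j * P' j i) (ℕP.n∸n≡0 K)) (ℚP.*-zeroˡ (P' 0 i))) n ⟩
        (M K ⊛ 0ₛ) n ≡⟨ ⊛-zeroʳ (M K) n ⟩
        0ℚ ∎

  expProduct-zero : ∀ L s → expProduct s L 0 ≗ one
  expProduct-zero zero    s n = refl
  expProduct-zero (suc L) s n = begin
    (monomial (s ℕ.* 0) (expCoeff s 0) ⊛ expProduct (suc s) L 0) n + 0ℚ
      ≡⟨ ℚP.+-identityʳ _ ⟩
    (monomial (s ℕ.* 0) (expCoeff s 0) ⊛ expProduct (suc s) L 0) n
      ≡⟨ cong (λ d → (monomial d (expCoeff s 0) ⊛ expProduct (suc s) L 0) n) (ℕP.*-zeroʳ s) ⟩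
    (one ⊛ expProduct (suc s) L 0) n ≡⟨ one-⊛ (expProduct (suc s) L 0) n ⟩
    expProduct (suc s) L 0 n         ≡⟨ expProduct-zero L (suc s) n ⟩
    one n                            ∎

  -- k!·[yᵏ] ∏_{j=1}^{L} exp(y x_j tʲ) agrees with Xᵏ below t^(k+L), where the
  -- truncation of X at t^L is invisible
  factorial-expProduct : ∀ k L n → n < k ℕ.+ L → ℕ→ℚ (k !) * expProduct 1 L k n ≡ X^ k n
  factorial-expProduct zero    L n _  = trans (ℚP.*-identityˡ (expProduct 1 L 0 n)) (expProduct-zero L 1 n)
  factorial-expProduct (suc k) L n lt = begin
    ℕ→ℚ (suc k ℕ.* k !) * E (suc k) n
      ≡⟨ cong (_* E (suc k) n) (ℕ→ℚ-homo-* (suc k) (k !)) ⟩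
    (ℕ→ℚ (suc k) * ℕ→ℚ (k !)) * E (suc k) n
      ≡⟨ solve 3 (λ a b c → (a :* b) :* c := b :* (a :* c)) refl (ℕ→ℚ (suc k)) (ℕ→ℚ (k !)) (E (suc k) n) ⟩
    ℕ→ℚ (k !) * (ℕ→ℚ (suc k) * E (suc k) n)
      ≡⟨ cong (ℕ→ℚ (k !) *_) (expProduct-derivative L 1 k n) ⟩
    ℕ→ℚ (k !) * (truncX 1 L ⊛ E k) n
      ≡⟨ sym (⊛-·ʳ (ℕ→ℚ (k !)) (truncX 1 L) (E k) n) ⟩
    (truncX 1 L ⊛ (ℕ→ℚ (k !) · E k)) n
      ≡⟨ sum-cong-on 0 (suc n) termwise ⟩
    (X ⊛ X^ k) n ∎
    where
    E : ℕ → Series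
    E = expProduct 1 L
    termwise : ∀ i → 0 ≤ i → i < suc n → truncX 1 L i * (ℕ→ℚ (k !) * E k (n ∸ i)) ≡ X i * X^ k (n ∸ i)
    termwise zero _ _ = begin
      truncX 1 L 0 * (ℕ→ℚ (k !) * E k n) ≡⟨ cong (_* (ℕ→ℚ (k !) * E k n)) (truncX-outside 1 L 0 (inj₁ (s≤s z≤n))) ⟩
      0ℚ * (ℕ→ℚ (k !) * E k n)           ≡⟨ ℚP.*-zeroˡ (ℕ→ℚ (k !) * E k n) ⟩
      0ℚ                                 ≡⟨ sym (ℚP.*-zeroˡ (X^ k n)) ⟩
      0ℚ * X^ k n                        ∎
    termwise (suc j) _ j<n with suc j ℕ.≤? L
    ... | yes j<L = cong₂ _*_ (truncX-inside 1 L (suc j) (s≤s z≤n) (s≤s j<L))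
                              (factorial-expProduct k L (n ∸ suc j) (∸-<-∸ lt (ℕP.≤-pred j<n) (s≤s z≤n)))
    ... | no  j≮L = begin
      truncX 1 L (suc j) * (ℕ→ℚ (k !) * E k (n ∸ suc j))
        ≡⟨ cong (_* (ℕ→ℚ (k !) * E k (n ∸ suc j))) (truncX-outside 1 L (suc j) (inj₂ (ℕP.≰⇒> j≮L))) ⟩
      0ℚ * (ℕ→ℚ (k !) * E k (n ∸ suc j)) ≡⟨ ℚP.*-zeroˡ (ℕ→ℚ (k !) * E k (n ∸ suc j)) ⟩
      0ℚ                                  ≡⟨ sym (ℚP.*-zeroʳ (x (suc j))) ⟩
      x (suc j) * 0ℚ                      ≡⟨ cong (x (suc j) *_) (sym (X^-vanish k (n ∸ suc j) below-k)) ⟩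
      x (suc j) * X^ k (n ∸ suc j)        ∎
      where
      below-k : n ∸ suc j < k
      below-k = subst (n ∸ suc j <_) (ℕP.m+n∸n≡m k (suc L))
                  (∸-<-∸ (subst (n <_) (sym (ℕP.+-suc k L)) lt) (ℕP.≤-pred j<n) (ℕP.≰⇒> j≮L))

  admissible? : ∀ {L} (s k n : ℕ) (α : Vec ℕ L) → Dec (vsum α ≡ k × wsumFrom s α ≡ n)
  admissible? s k n α = (vsum α ℕ.≟ k) ×-dec (wsumFrom s α ℕ.≟ n)

  vfactProd≢0 : ∀ {L} (α : Vec ℕ L) → ℕ.NonZero (vfactProd α)
  vfactProd≢0 []      = _
  vfactProd≢0 (a ∷ α) = ℕP.m*n≢0 (a !) (vfactProd α) {{a ℕP.!≢0}} {{vfactProd≢0 α}}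

  weight : ∀ {L} → ℕ → Vec ℕ L → ℚ
  weight s α = 1/ℕ (vfactProd α) {{vfactProd≢0 α}} * zProdFrom s z α

  admissibleWeight : ∀ {L} → ℕ → ℕ → ℕ → Vec ℕ L → ℚ
  admissibleWeight s k n α = if does (admissible? s k n α) then weight s α else 0ℚ

  admissibleSum : ℕ → ℕ → ℕ → ℕ → ℕ → ℚ
  admissibleSum s L K k n = sumℚ (map (admissibleWeight s k n) (vecsUpTo K L))

  weight-cons : ∀ {L} s a (α : Vec ℕ L) → weight s (a ∷ α) ≡ expCoeff s a * weight (suc s) α
  weight-cons s a α = begin
    1/ℕ (a ! ℕ.* vfactProd α) {{vfactProd≢0 (a ∷ α)}} * (p * ζ)
      ≡⟨ cong (_* (p * ζ)) (1/ℕ-homo-* (a !) (vfactProd α) {{a ℕP.!≢0}} {{vfactProd≢0 α}}) ⟩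
    (ra * rα) * (p * ζ)
      ≡⟨ solve 4 (λ ra rα p ζ → (ra :* rα) :* (p :* ζ) := (p :* ra) :* (rα :* ζ)) refl ra rα p ζ ⟩
    (p * ra) * (rα * ζ) ∎
    where
    ra rα p ζ : ℚ
    ra = 1/ℕ (a !) {{a ℕP.!≢0}}
    rα = 1/ℕ (vfactProd α) {{vfactProd≢0 α}}
    p  = x s ^ℚ a
    ζ  = zProdFrom (suc s) z α

  admissible-cons : ∀ {L} s k n a (α : Vec ℕ L) → a ≤ k → s ℕ.* a ≤ n →
    (vsum (a ∷ α) ≡ k × wsumFrom s (a ∷ α) ≡ n) ⇔ (vsum α ≡ k ∸ a × wsumFrom (suc s) α ≡ n ∸ s ℕ.* a)
  admissible-cons s k n a α a≤k sa≤n = mk⇔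
    (λ (Σα≡k , Σjα≡n) → trans (sym (ℕP.m+n∸m≡n a (vsum α))) (cong (_∸ a) Σα≡k)
                      , trans (sym (ℕP.m+n∸m≡n (s ℕ.* a) (wsumFrom (suc s) α))) (cong (_∸ s ℕ.* a) Σjα≡n))
    (λ (Σα≡k , Σjα≡n) → trans (cong (a ℕ.+_) Σα≡k) (ℕP.m+[n∸m]≡n a≤k)
                      , trans (cong (s ℕ.* a ℕ.+_) Σjα≡n) (ℕP.m+[n∸m]≡n sa≤n))

  admissibleWeight-cons : ∀ {L} s k n a (α : Vec ℕ L) → a ≤ k → s ℕ.* a ≤ n →
    admissibleWeight s k n (a ∷ α) ≡ expCoeff s a * admissibleWeight (suc s) (k ∸ a) (n ∸ s ℕ.* a) α
  admissibleWeight-cons s k n a α a≤k sa≤n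
    rewrite does-⇔ (admissible-cons s k n a α a≤k sa≤n)
                   (admissible? s k n (a ∷ α)) (admissible? (suc s) (k ∸ a) (n ∸ s ℕ.* a) α)
    with does (admissible? (suc s) (k ∸ a) (n ∸ s ℕ.* a) α)
  ... | true  = weight-cons s a α
  ... | false = sym (ℚP.*-zeroʳ (expCoeff s a))

  admissibleWeight-out : ∀ {L} s k n a (α : Vec ℕ L) → ¬ (a ≤ k × s ℕ.* a ≤ n) →
    admissibleWeight s k n (a ∷ α) ≡ 0ℚ
  admissibleWeight-out s k n a α out =
    cong (λ b → if b then weight s (a ∷ α) else 0ℚ) (dec-false (admissible? s k n (a ∷ α)) inadmissible)
    where
    inadmissible : ¬ (vsum (a ∷ α) ≡ k × wsumFrom s (a ∷ α) ≡ n)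
    inadmissible (Σα≡k , Σjα≡n) = out ( subst (a ≤_) Σα≡k (ℕP.m≤m+n a (vsum α))
                                      , subst (s ℕ.* a ≤_) Σjα≡n (ℕP.m≤m+n (s ℕ.* a) (wsumFrom (suc s) α)))

  -- expanding the finite product of exponentials: summing over the first
  -- exponent a is exactly the Cauchy product with exp(y x_s tˢ)
  admissibleSum-expProduct : ∀ L s K k n → k ≤ K → admissibleSum s L K k n ≡ expProduct s L k n
  admissibleSum-expProduct zero    s K zero    zero    _   = refl
  admissibleSum-expProduct zero    s K zero    (suc n) _   = refl
  admissibleSum-expProduct zero    s K (suc k) n       _   = refl
  admissibleSum-expProduct (suc L) s K k       n       k≤K = begin
    sumℚ (map g (concatMap (λ a → map (a ∷_) αs) (upTo (suc K))))
      ≡⟨ sumℚ-concatMap g (λ a → map (a ∷_) αs) (upTo (suc K)) ⟩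
    sumℚ (map (λ a → sumℚ (map g (map (a ∷_) αs))) (upTo (suc K)))
      ≡⟨ sumℚ-applyUpTo (λ a → sumℚ (map g (map (a ∷_) αs))) (λ a → a) (suc K) ⟩
    sumFrom 0 (suc K) (λ a → sumℚ (map g (map (a ∷_) αs)))
      ≡⟨ sum-cong 0 (suc K) (λ a → cong sumℚ (sym (LP.map-∘ αs))) ⟩
    sumFrom 0 (suc K) S
      ≡⟨ cong (λ N → sumFrom 0 (suc N) S) (sym (ℕP.m+[n∸m]≡n k≤K)) ⟩
    sumFrom 0 (suc k ℕ.+ (K ∸ k)) S
      ≡⟨ sum-split 0 (suc k) (K ∸ k) S ⟩
    sumFrom 0 (suc k) S + sumFrom (suc k) (K ∸ k) S
      ≡⟨ cong₂ _+_ (sum-cong-on 0 (suc k) (λ a _ a<sk → first-exponent a (ℕP.≤-pred a<sk)))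
                   (sum-zero-on (suc k) (K ∸ k) (λ a k<a _ → too-large a k<a)) ⟩
    expProduct s (suc L) k n + 0ℚ
      ≡⟨ ℚP.+-identityʳ _ ⟩
    expProduct s (suc L) k n ∎
    where
    g : Vec ℕ (suc L) → ℚ
    g = admissibleWeight s k n
    αs : List (Vec ℕ L)
    αs = vecsUpTo K L
    S : ℕ → ℚ
    S a = sumℚ (map (λ α → g (a ∷ α)) αs)
    M : ℕ → Series
    M a = monomial (s ℕ.* a) (expCoeff s a)

    first-exponent : ∀ a → a ≤ k → S a ≡ (M a ⊛ expProduct (suc s) L (k ∸ a)) n
    first-exponent a a≤k with s ℕ.* a ℕ.≤? n
    ... | yes sa≤n = begin
      S a
        ≡⟨ cong sumℚ (LP.map-cong (λ α → admissibleWeight-cons s k n a α a≤k sa≤n) αs) ⟩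
      sumℚ (map (λ α → expCoeff s a * admissibleWeight (suc s) (k ∸ a) (n ∸ s ℕ.* a) α) αs)
        ≡⟨ sumℚ-*ˡ (expCoeff s a) (admissibleWeight (suc s) (k ∸ a) (n ∸ s ℕ.* a)) αs ⟩
      expCoeff s a * admissibleSum (suc s) L K (k ∸ a) (n ∸ s ℕ.* a)
        ≡⟨ cong (expCoeff s a *_) (admissibleSum-expProduct L (suc s) K (k ∸ a) (n ∸ s ℕ.* a)
                                     (ℕP.≤-trans (ℕP.m∸n≤m k a) k≤K)) ⟩
      expCoeff s a * expProduct (suc s) L (k ∸ a) (n ∸ s ℕ.* a)
        ≡⟨ sym (⊛-monomial-≤ (s ℕ.* a) (expCoeff s a) (expProduct (suc s) L (k ∸ a)) n sa≤n) ⟩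
      (M a ⊛ expProduct (suc s) L (k ∸ a)) n ∎
    ... | no sa≰n =
      trans (sumℚ-zero αs (λ α → admissibleWeight-out s k n a α (λ (_ , sa≤n) → sa≰n sa≤n)))
            (sym (⊛-monomial-> (s ℕ.* a) (expCoeff s a) (expProduct (suc s) L (k ∸ a)) n (ℕP.≰⇒> sa≰n)))

    too-large : ∀ a → k < a → S a ≡ 0ℚ
    too-large a k<a = sumℚ-zero αs (λ α → admissibleWeight-out s k n a α (λ (a≤k , _) → ℕP.<⇒≱ k<a a≤k))

  bell-as-power : ∀ n k → k ≤ n → (ℕ→ℚ (k !) * inv! n) * bell n k z ≡ X^ k n
  bell-as-power n k k≤n = begin
    (ℕ→ℚ (k !) * inv! n) * bell n k z
      ≡⟨ cong ((ℕ→ℚ (k !) * inv! n) *_) bell-expanded ⟩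
    (ℕ→ℚ (k !) * inv! n) * (ℕ→ℚ (n !) * expProduct 1 L k n)
      ≡⟨ solve 4 (λ a b c d → (a :* b) :* (c :* d) := (a :* d) :* (c :* b)) refl
               (ℕ→ℚ (k !)) (inv! n) (ℕ→ℚ (n !)) (expProduct 1 L k n) ⟩
    (ℕ→ℚ (k !) * expProduct 1 L k n) * (ℕ→ℚ (n !) * inv! n)
      ≡⟨ cong₂ _*_ (factorial-expProduct k L n n<k+L) (ℕ→ℚ-*-1/ℕ (n !) {{n ℕP.!≢0}}) ⟩
    X^ k n * 1ℚ ≡⟨ ℚP.*-identityʳ _ ⟩
    X^ k n      ∎
    where
    L : ℕ
    L = n ∸ k ℕ.+ 1
    n<k+L : n < k ℕ.+ L
    n<k+L = subst (n <_) (trans (ℕP.+-comm 1 n) (trans (cong (ℕ._+ 1) (sym (ℕP.m+[n∸m]≡n k≤n)))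
                                                       (ℕP.+-assoc k (n ∸ k) 1)))
                  (ℕP.n<1+n n)
    term-expanded : ∀ α → (if does (admissible? 1 k n α) then bellTerm n z α else 0ℚ)
                          ≡ ℕ→ℚ (n !) * admissibleWeight 1 k n α
    term-expanded α with does (admissible? 1 k n α)
    ... | true  = trans (cong (_* zProdFrom 1 z α) (/-as-* (n !) (vfactProd α) {{vfactProd≢0 α}}))
                        (ℚP.*-assoc (ℕ→ℚ (n !)) _ _)
    ... | false = sym (ℚP.*-zeroʳ (ℕ→ℚ (n !)))
    bell-expanded : bell n k z ≡ ℕ→ℚ (n !) * expProduct 1 L k n
    bell-expanded = begin
      bell n k z
        ≡⟨ sumℚ-filter (admissible? 1 k n) (bellTerm n z) (vecsUpTo k L) ⟩
      sumℚ (map (λ α → if does (admissible? 1 k n α) then bellTerm n z α else 0ℚ) (vecsUpTo k L))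
        ≡⟨ cong sumℚ (LP.map-cong term-expanded (vecsUpTo k L)) ⟩
      sumℚ (map (λ α → ℕ→ℚ (n !) * admissibleWeight 1 k n α) (vecsUpTo k L))
        ≡⟨ sumℚ-*ˡ (ℕ→ℚ (n !)) (admissibleWeight 1 k n) (vecsUpTo k L) ⟩
      ℕ→ℚ (n !) * admissibleSum 1 L k k n
        ≡⟨ cong (ℕ→ℚ (n !) *_) (admissibleSum-expProduct L 1 k k n ℕP.≤-refl) ⟩
      ℕ→ℚ (n !) * expProduct 1 L k n ∎

pow : ℕ → ℕ → ℚ
pow m k = ℕ→ℚ m ^ℚ (k ∸ 1)

module IteratedInvert (x : ℕ → ℚ) where

  open ≡-Reasoning
  open FiniteSums
  open PowerSeries
  open NatCast using (ℕ→ℚ-homo-+)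
  open Powers x

  -- [tⁿ] Y_m; the powers Xᵏ with k > n do not contribute
  Y : ℕ → Series
  Y m n = sumFrom 1 n (λ k → pow m k * X^ k n)

  Y-extend : ∀ m n N → n ≤ N → Y m n ≡ sumFrom 1 N (λ k → pow m k * X^ k n)
  Y-extend m n N n≤N = begin
    sumFrom 1 n t                            ≡⟨ sym (ℚP.+-identityʳ _) ⟩
    sumFrom 1 n t + 0ℚ                       ≡⟨ cong (sumFrom 1 n t +_) (sym (sum-zero-on (suc n) (N ∸ n) vanish)) ⟩
    sumFrom 1 n t + sumFrom (suc n) (N ∸ n) t ≡⟨ sym (sum-split 1 n (N ∸ n) t) ⟩
    sumFrom 1 (n ℕ.+ (N ∸ n)) t               ≡⟨ cong (λ L → sumFrom 1 L t) (ℕP.m+[n∸m]≡n n≤N) ⟩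
    sumFrom 1 N t                            ∎
    where
    t : ℕ → ℚ
    t k = pow m k * X^ k n
    vanish : ∀ k → suc n ≤ k → k < suc n ℕ.+ (N ∸ n) → t k ≡ 0ℚ
    vanish k n<k _ = trans (cong (pow m k *_) (X^-vanish k n n<k)) (ℚP.*-zeroʳ (pow m k))

  -- Y_m = X + m·(X ⊛ Y_m): peel one factor X off each power
  Y-fixpoint : ∀ m → Y m ≗ X ⊕ ℕ→ℚ m · (X ⊛ Y m)
  Y-fixpoint m n = sym (begin
    X n + M * (X ⊛ Y m) n
      ≡⟨ cong (λ q → X n + M * q) X⊛Y ⟩
    X n + M * sumFrom 1 n (λ k → pow m k * X^ (suc k) n)
      ≡⟨ cong (X n +_) (sym (sum-*ˡ 1 n M (λ k → pow m k * X^ (suc k) n))) ⟩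
    X n + sumFrom 1 n (λ k → M * (pow m k * X^ (suc k) n))
      ≡⟨ cong (X n +_) (sum-cong-on 1 n raise-power) ⟩
    X n + sumFrom 1 n (λ k → pow m (suc k) * X^ (suc k) n)
      ≡⟨ cong (X n +_) (sym (sum-shift 1 n t)) ⟩
    X n + sumFrom 2 n t
      ≡⟨ cong (_+ sumFrom 2 n t) (sym (trans (ℚP.*-identityˡ (X^ 1 n)) (X^1 n))) ⟩
    sumFrom 1 (suc n) t
      ≡⟨ sym (Y-extend m n (suc n) (ℕP.n≤1+n n)) ⟩
    Y m n ∎)
    where
    M : ℚ
    M = ℕ→ℚ m
    t : ℕ → ℚ
    t k = pow m k * X^ k n
    X⊛Y : (X ⊛ Y m) n ≡ sumFrom 1 n (λ k → pow m k * X^ (suc k) n)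
    X⊛Y = begin
      (X ⊛ Y m) n
        ≡⟨ sum-cong 0 (suc n) (λ i → cong (X i *_) (Y-extend m (n ∸ i) n (ℕP.m∸n≤m n i))) ⟩
      (X ⊛ (λ i → sumFrom 1 n (λ k → (pow m k · X^ k) i))) n
        ≡⟨ ⊛-sumʳ 1 n X (λ k → pow m k · X^ k) n ⟩
      sumFrom 1 n (λ k → (X ⊛ (pow m k · X^ k)) n)
        ≡⟨ sum-cong 1 n (λ k → ⊛-·ʳ (pow m k) X (X^ k) n) ⟩
      sumFrom 1 n (λ k → pow m k * X^ (suc k) n) ∎
    raise-power : ∀ k → 1 ≤ k → k < 1 ℕ.+ n → M * (pow m k * X^ (suc k) n) ≡ pow m (suc k) * X^ (suc k) n
    raise-power (suc k) _ _ = sym (ℚP.*-assoc M (pow m (suc k)) (X^ (suc (suc k)) n))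

  Y-zero : Y 0 ≗ X
  Y-zero n = trans (Y-fixpoint 0 n)
                   (trans (cong (X n +_) (ℚP.*-zeroˡ ((X ⊛ Y 0) n))) (ℚP.+-identityʳ (X n)))

  -- D = Y_{m+1} - Y_m - Y_{m+1}·Y_m satisfies D = (m+1)·(X ⊛ D), hence D = 0
  module _ (m : ℕ) where

    private
      Y' Yₘ : Series
      c : ℚ
      Y' = Y (suc m)
      Yₘ = Y m
      c = ℕ→ℚ (suc m)

    defect : Series
    defect = Y' ⊕ ⊖ Yₘ ⊕ ⊖ (Y' ⊛ Yₘ)

    defect-fixpoint : defect ≗ c · (X ⊛ defect)
    defect-fixpoint n = begin
      (Y' n + - Yₘ n) + - (Y' ⊛ Yₘ) n
        ≡⟨ cong₂ (λ u v → (Y' n + - u) + - v) (Y-fixpoint m n) Y'⊛Y ⟩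
      (Y' n + - (X n + M * b)) + - (b + c * e)
        ≡⟨ cong (λ u → (u + - (X n + M * b)) + - (b + c * e)) (Y-fixpoint (suc m) n) ⟩
      ((X n + c * a) + - (X n + M * b)) + - (b + c * e)
        ≡⟨ cong (λ c' → ((X n + c' * a) + - (X n + M * b)) + - (b + c' * e)) (ℕ→ℚ-homo-+ 1 m) ⟩
      ((X n + (1ℚ + M) * a) + - (X n + M * b)) + - (b + (1ℚ + M) * e)
        ≡⟨ solve 5 (λ x M a b e → ((x :+ (con 1ℚ :+ M) :* a) :+ :- (x :+ M :* b)) :+ :- (b :+ (con 1ℚ :+ M) :* e)
                                := (con 1ℚ :+ M) :* ((a :+ :- b) :+ :- e)) refl (X n) M a b e ⟩
      (1ℚ + M) * ((a + - b) + - e)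
        ≡⟨ cong₂ _*_ (sym (ℕ→ℚ-homo-+ 1 m)) (sym X⊛defect) ⟩
      c * (X ⊛ defect) n ∎
      where
      M a b e : ℚ
      M = ℕ→ℚ m
      a = (X ⊛ Y') n
      b = (X ⊛ Yₘ) n
      e = (X ⊛ (Y' ⊛ Yₘ)) n
      Y'⊛Y : (Y' ⊛ Yₘ) n ≡ b + c * e
      Y'⊛Y = begin
        (Y' ⊛ Yₘ) n                           ≡⟨ ⊛-congˡ Yₘ (Y-fixpoint (suc m)) n ⟩
        ((X ⊕ c · (X ⊛ Y')) ⊛ Yₘ) n           ≡⟨ ⊛-distribʳ-⊕ X (c · (X ⊛ Y')) Yₘ n ⟩
        b + ((c · (X ⊛ Y')) ⊛ Yₘ) n           ≡⟨ cong (b +_) (⊛-·ˡ c (X ⊛ Y') Yₘ n) ⟩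
        b + c * ((X ⊛ Y') ⊛ Yₘ) n             ≡⟨ cong (λ q → b + c * q) (⊛-assoc X Y' Yₘ n) ⟩
        b + c * e                             ∎
      X⊛defect : (X ⊛ defect) n ≡ (a + - b) + - e
      X⊛defect = begin
        (X ⊛ defect) n
          ≡⟨ ⊛-distribˡ-⊕ X (Y' ⊕ ⊖ Yₘ) (⊖ (Y' ⊛ Yₘ)) n ⟩
        (X ⊛ (Y' ⊕ ⊖ Yₘ)) n + (X ⊛ ⊖ (Y' ⊛ Yₘ)) n
          ≡⟨ cong₂ _+_ (⊛-distribˡ-⊕ X Y' (⊖ Yₘ) n) (⊛-⊖ʳ X (Y' ⊛ Yₘ) n) ⟩
        (a + (X ⊛ ⊖ Yₘ) n) + - e
          ≡⟨ cong (λ q → (a + q) + - e) (⊛-⊖ʳ X Yₘ n) ⟩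
        (a + - b) + - e ∎

    -- hence (1 + Y_{m+1})·(1 - Y_m) = 1 + D = 1
    Y-invert : IsInvertTransform Yₘ Y'
    Y-invert n = begin
      cauchy (onePlus Y') (oneMinus Yₘ) n
        ≡⟨ trans (⊛-congˡ (oneMinus Yₘ) onePlus≗ n) (⊛-congʳ (one ⊕ Y') oneMinus≗ n) ⟩
      ((one ⊕ Y') ⊛ (one ⊕ ⊖ Yₘ)) n
        ≡⟨ ⊛-distribʳ-⊕ one Y' (one ⊕ ⊖ Yₘ) n ⟩
      (one ⊛ (one ⊕ ⊖ Yₘ)) n + (Y' ⊛ (one ⊕ ⊖ Yₘ)) n
        ≡⟨ cong₂ _+_ (one-⊛ (one ⊕ ⊖ Yₘ) n) (⊛-distribˡ-⊕ Y' one (⊖ Yₘ) n) ⟩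
      (one n + - Yₘ n) + ((Y' ⊛ one) n + (Y' ⊛ ⊖ Yₘ) n)
        ≡⟨ cong₂ (λ u v → (one n + - Yₘ n) + (u + v)) (trans (⊛-comm Y' one n) (one-⊛ Y' n)) (⊛-⊖ʳ Y' Yₘ n) ⟩
      (one n + - Yₘ n) + (Y' n + - (Y' ⊛ Yₘ) n)
        ≡⟨ solve 4 (λ d y y' w → (d :+ :- y) :+ (y' :+ :- w) := d :+ ((y' :+ :- y) :+ :- w))
                 refl (one n) (Yₘ n) (Y' n) ((Y' ⊛ Yₘ) n) ⟩
      one n + defect n
        ≡⟨ cong (one n +_) (X-contraction c defect defect-fixpoint n) ⟩
      one n + 0ℚ
        ≡⟨ ℚP.+-identityʳ (one n) ⟩
      one n
        ≡⟨ one≗oneSeries n ⟩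
      oneSeries n ∎
      where
      onePlus≗ : onePlus Y' ≗ one ⊕ Y'
      onePlus≗ zero    = sym (ℚP.+-identityʳ 1ℚ)
      onePlus≗ (suc i) = sym (ℚP.+-identityˡ (Y' (suc i)))
      oneMinus≗ : oneMinus Yₘ ≗ one ⊕ ⊖ Yₘ
      oneMinus≗ zero    = sym (ℚP.+-identityʳ 1ℚ)
      oneMinus≗ (suc i) = sym (ℚP.+-identityˡ (- Yₘ (suc i)))
      one≗oneSeries : one ≗ oneSeries
      one≗oneSeries zero    = refl
      one≗oneSeries (suc i) = refl

  Y-iterated : ∀ m → IsIteratedInvert m x (Y m)
  Y-iterated zero    (suc n) _ = sym (Y-zero (suc n))
  Y-iterated (suc m)           = Y m , Y-iterated m , Y-invert m

Y-cong : ∀ {x x' : ℕ → ℚ} → (∀ j → x (suc j) ≡ x' (suc j)) → ∀ m → IteratedInvert.Y x m ≗ IteratedInvert.Y x' m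
Y-cong h m n = FiniteSums.sum-cong 1 n (λ k → cong (pow m k *_) (X^-cong h k n))

invert-congʳ : ∀ {x y y' : ℕ → ℚ} → (∀ n → y (suc n) ≡ y' (suc n)) →
               IsInvertTransform x y → IsInvertTransform x y'
invert-congʳ {x} {y} {y'} y≡y' inv n = trans (sym (PowerSeries.⊛-congˡ (oneMinus x) onePlus≗ n)) (inv n)
  where
  onePlus≗ : onePlus y ≗ onePlus y'
  onePlus≗ zero    = refl
  onePlus≗ (suc i) = y≡y' i

iterated-congʳ : ∀ m {x y y' : ℕ → ℚ} → (∀ n → y (suc n) ≡ y' (suc n)) →
                 IsIteratedInvert m x y → IsIteratedInvert m x y'
iterated-congʳ zero    y≡y' x≡y (suc n) 1≤n = trans (x≡y (suc n) 1≤n) (y≡y' n)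
iterated-congʳ (suc m) y≡y' (w , w-iterated , inv) = w , w-iterated , invert-congʳ y≡y' inv

-- f_m(n) = [tⁿ] Y_m for X = Σ_{j≥1} f₀(j) tʲ  (n ≥ 1): the Bell sum defining
-- f_m(n) is Σ_k m^(k-1)·[tⁿ] Xᵏ by bell-as-power with z_j = j!·f₀(j)
fSeq-as-Y : ∀ (f₀ : ℕ → ℕ) m n → fSeq m f₀ (suc n) ≡ IteratedInvert.Y (λ j → ℕ→ℚ (f₀ j)) m (suc n)
fSeq-as-Y f₀ m n = trans (FiniteSums.sum-cong-on 1 (suc n) termwise) (Y-cong {x} {λ j → ℕ→ℚ (f₀ j)} x≡f₀ m (suc n))
  where
  open ≡-Reasoning
  open NatCast
  z : ℕ → ℚ
  z i = ℕ→ℚ (i ! ℕ.* f₀ i)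
  open BellCoefficients z using (x; bell-as-power)
  open Powers x using (X^)
  x≡f₀ : ∀ j → x (suc j) ≡ ℕ→ℚ (f₀ (suc j))
  x≡f₀ j = begin
    ℕ→ℚ (J ! ℕ.* f₀ J) * r          ≡⟨ cong (_* r) (ℕ→ℚ-homo-* (J !) (f₀ J)) ⟩
    (N * ℕ→ℚ (f₀ J)) * r            ≡⟨ solve 3 (λ N y r → (N :* y) :* r := y :* (N :* r)) refl N (ℕ→ℚ (f₀ J)) r ⟩
    ℕ→ℚ (f₀ J) * (N * r)            ≡⟨ cong (ℕ→ℚ (f₀ J) *_) (ℕ→ℚ-*-1/ℕ (J !) {{J ℕP.!≢0}}) ⟩
    ℕ→ℚ (f₀ J) * 1ℚ                 ≡⟨ ℚP.*-identityʳ _ ⟩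
    ℕ→ℚ (f₀ J)                      ∎
    where
    J : ℕ
    J = suc j
    N r : ℚ
    N = ℕ→ℚ (J !)
    r = 1/ℕ (J !) {{J ℕP.!≢0}}
  termwise : ∀ k → 1 ≤ k → k < 1 ℕ.+ suc n →
    ((ℕ→ℚ (k !) * inv! (suc n)) * (ℕ→ℚ m ^ℚ (k ∸ 1))) * bell (suc n) k z ≡ pow m k * X^ k (suc n)
  termwise k _ k≤n = begin
    ((a * b) * p) * bell (suc n) k z ≡⟨ solve 4 (λ a b p q → ((a :* b) :* p) :* q := p :* ((a :* b) :* q)) refl a b p (bell (suc n) k z) ⟩
    p * ((a * b) * bell (suc n) k z) ≡⟨ cong (p *_) (bell-as-power (suc n) k (ℕP.≤-pred k≤n)) ⟩
    p * X^ k (suc n)                 ∎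
    where
    a b p : ℚ
    a = ℕ→ℚ (k !)
    b = inv! (suc n)
    p = ℕ→ℚ m ^ℚ (k ∸ 1)

module ListFacts where

  unique-concatMap : ∀ {A B : Set} (h : A → List B) {xs} → Unique xs →
    (∀ {x} → x ∈ xs → Unique (h x)) →
    (∀ {x y w} → x ∈ xs → y ∈ xs → w ∈ h x → w ∈ h y → x ≡ y) → Unique (concatMap h xs)
  unique-concatMap h {[]}     _             _      _        = []
  unique-concatMap h {x ∷ xs} (x∉xs ∷ uxs) unique separate =
    UniqueP.++⁺ (unique (here refl))
                (unique-concatMap h uxs (λ y∈ → unique (there y∈)) (λ p q → separate (there p) (there q)))
                disjoint
    where
    disjoint : ∀ {w} → ¬ (w ∈ h x × w ∈ concatMap h xs)
    disjoint (w∈hx , w∈rest) with find (∈P.∈-concatMap⁻ h {xs} w∈rest)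
    ... | y , y∈xs , w∈hy = All.lookup x∉xs y∈xs (separate (here refl) (there y∈xs) w∈hx w∈hy)

  unique-map : ∀ {A B : Set} (f : A → B) {xs} → Unique xs →
    (∀ {x y} → x ∈ xs → y ∈ xs → f x ≡ f y → x ≡ y) → Unique (map f xs)
  unique-map f {[]}     _           _   = []
  unique-map f {x ∷ xs} (x∉xs ∷ u) inj =
    AllP.map⁺ (All.tabulate (λ y∈xs fx≡fy → All.lookup x∉xs y∈xs (inj (here refl) (there y∈xs) fx≡fy)))
    ∷ unique-map f u (λ p q → inj (there p) (there q))

  range : ℕ → ℕ → List ℕ
  range s L = applyUpTo (s ℕ.+_) L

  range-∈⁻ : ∀ s L {j} → j ∈ range s L → s ≤ j × j < s ℕ.+ L
  range-∈⁻ s L j∈ with ∈P.∈-applyUpTo⁻ (s ℕ.+_) j∈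
  ... | i , i<L , refl = ℕP.m≤m+n s i , ℕP.+-monoʳ-< s i<L

  range-∈⁺ : ∀ s L {j} → s ≤ j → j < s ℕ.+ L → j ∈ range s L
  range-∈⁺ s L {j} s≤j j<s+L = subst (_∈ range s L) (ℕP.m+[n∸m]≡n s≤j)
    (∈P.∈-applyUpTo⁺ (s ℕ.+_) (ℕP.+-cancelˡ-< s (j ∸ s) L (subst (_< s ℕ.+ L) (sym (ℕP.m+[n∸m]≡n s≤j)) j<s+L)))

  range-unique : ∀ s L → Unique (range s L)
  range-unique s L = UniqueP.applyUpTo⁺₁ (s ℕ.+_) L (λ i<j _ eq → ℕP.<⇒≢ i<j (ℕP.+-cancelˡ-≡ s _ _ eq))

-- We enumerate 𝒰^m_{b,n} explicitly as a block of some U_j followed by a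
-- concatenation of U^m-blocks.  Blocks are recognisable inside a word — a
-- block is a letter ≥ b followed by letters < b — so the decomposition is
-- unique, the enumeration is repetition-free, and counting it gives
-- |concatenations of length n| = m·Σ_j |U_j|·|concatenations of length n-j|,
-- the fixpoint equation of Y_m for x_j = |U_j|.
module Words (b m : ℕ) (1≤m : 1 ≤ m) (U : ℕ → List Word)
             (U-unique : ∀ j → 1 ≤ j → Unique (U j))
             (U⊆W : ∀ j → 1 ≤ j → All (InW b j) (U j)) where

  open ≡-Reasoning
  open ListFacts
  open FiniteSums
  open PowerSeries
  open ListSums

  relabel : ℕ → Word → Word
  relabel c w = c ∷ drop 1 w

  Um : ℕ → List Word
  Um j = concatMap (λ c → map (relabel c) (U j)) (range b m)

  joinBlocks : ℕ → (ℕ → List Word) → (ℕ → List Word) → List Word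
  joinBlocks N B T = concatMap (λ j → concatMap (λ u → map (u ++_) (T j)) (B j)) (range 1 N)

  -- concats f n: concatenations of U^m-blocks of total length n, for n ≤ f
  -- (the fuel f makes the recursion structural)
  concats : ℕ → ℕ → List Word
  concats f       zero    = [] ∷ []
  concats zero    (suc n) = []
  concats (suc f) (suc n) = joinBlocks (suc n) Um (λ j → concats f (suc n ∸ j))

  scriptU : ℕ → List Word
  scriptU n = joinBlocks n U (λ j → concats n (n ∸ j))

  StartsBlock : Word → Set
  StartsBlock []      = ⊤
  StartsBlock (c ∷ _) = b ≤ c

  record Block (j : ℕ) (u : Word) : Set where
    constructor block
    field
      lead     : ℕ
      rest     : Word
      shape    : u ≡ lead ∷ rest
      rest<b   : All (_< b) rest
      b≤lead   : b ≤ lead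
      lead<b+m : lead < b ℕ.+ m
      length≡j : length u ≡ j

  b<b+m : b < b ℕ.+ m
  b<b+m = ℕP.m<m+n b 1≤m

  U-member : ∀ j w → 1 ≤ j → w ∈ U j → Σ Word λ r → w ≡ b ∷ r × All (_< b) r × length w ≡ j
  U-member j w 1≤j w∈ with All.lookup (U⊆W j 1≤j) w∈
  ... | |w|≡j , r , w≡br , r<b = r , w≡br , r<b , |w|≡j

  U-block : ∀ j u → 1 ≤ j → u ∈ U j → Block j u
  U-block j u 1≤j u∈ with U-member j u 1≤j u∈
  ... | r , refl , r<b , |u|≡j = block b r refl r<b ℕP.≤-refl b<b+m |u|≡j

  U-InUm : ∀ j u → 1 ≤ j → u ∈ U j → Σ Word λ r → u ≡ b ∷ r × InUm b m U j u
  U-InUm j u 1≤j u∈ with U-member j u 1≤j u∈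
  ... | r , refl , _ , _ = r , refl , (b , r , ℕP.≤-refl , b<b+m , refl , u∈)

  InUm-block : ∀ j u → 1 ≤ j → InUm b m U j u → Block j u
  InUm-block j u 1≤j (c , r , b≤c , c<b+m , refl , br∈) with U-member j (b ∷ r) 1≤j br∈
  ... | _ , refl , r<b , |u|≡j = block c r refl r<b b≤c c<b+m |u|≡j

  Um-∈⁻ : ∀ j u → 1 ≤ j → u ∈ Um j → InUm b m U j u
  Um-∈⁻ j u 1≤j u∈ with find (∈P.∈-concatMap⁻ (λ c → map (relabel c) (U j)) {range b m} u∈)
  ... | c , c∈ , u∈' with ∈P.∈-map⁻ (relabel c) u∈'
  ... | w , w∈ , refl with U-member j w 1≤j w∈
  ... | r , refl , _ = c , r , proj₁ (range-∈⁻ b m c∈) , proj₂ (range-∈⁻ b m c∈) , refl , w∈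

  Um-∈⁺ : ∀ j u → InUm b m U j u → u ∈ Um j
  Um-∈⁺ j u (c , r , b≤c , c<b+m , refl , br∈) =
    ∈P.∈-concatMap⁺ (λ c → map (relabel c) (U j)) {range b m}
      (lose (range-∈⁺ b m b≤c c<b+m) (∈P.∈-map⁺ (relabel c) br∈))

  block-prefix : ∀ {j j' u u' v v'} → Block j u → Block j' u' → StartsBlock v → StartsBlock v' →
                 u ++ v ≡ u' ++ v' → u ≡ u'
  block-prefix (block c r refl r<b _ _ _) (block c' r' refl r'<b _ _ _) v-start v'-start eq =
    cong₂ _∷_ (LP.∷-injectiveˡ eq) (rests r<b r'<b v-start v'-start (LP.∷-injectiveʳ eq))
    where
    rests : ∀ {r r' v v' : Word} → All (_< b) r → All (_< b) r' → StartsBlock v → StartsBlock v' →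
            r ++ v ≡ r' ++ v' → r ≡ r'
    rests {[]}    {[]}      _           _            _   _   _  = refl
    rests {[]}    {x ∷ r'} {y ∷ v} _ (x<b ∷ _) b≤y _ eq =
      ⊥-elim (ℕP.<⇒≱ x<b (subst (b ≤_) (LP.∷-injectiveˡ eq) b≤y))
    rests {x ∷ r} {[]} {v' = y ∷ v'} (x<b ∷ _) _ _ b≤y eq =
      ⊥-elim (ℕP.<⇒≱ x<b (subst (b ≤_) (sym (LP.∷-injectiveˡ eq)) b≤y))
    rests {x ∷ r} {x' ∷ r'} (_ ∷ r<b) (_ ∷ r'<b) v-start v'-start eq =
      cong₂ _∷_ (LP.∷-injectiveˡ eq) (rests r<b r'<b v-start v'-start (LP.∷-injectiveʳ eq))

  joinBlocks-∈⁻ : ∀ N B T w → w ∈ joinBlocks N B T →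
    Σ ℕ λ j → Σ Word λ u → Σ Word λ v → j ∈ range 1 N × u ∈ B j × v ∈ T j × w ≡ u ++ v
  joinBlocks-∈⁻ N B T w w∈ with find (∈P.∈-concatMap⁻ (λ j → concatMap (λ u → map (u ++_) (T j)) (B j)) {range 1 N} w∈)
  ... | j , j∈ , w∈' with find (∈P.∈-concatMap⁻ (λ u → map (u ++_) (T j)) {B j} w∈')
  ... | u , u∈ , w∈'' with ∈P.∈-map⁻ (u ++_) w∈''
  ... | v , v∈ , w≡uv = j , u , v , j∈ , u∈ , v∈ , w≡uv

  joinBlocks-∈⁺ : ∀ N B T j u v → 1 ≤ j → j ≤ N → u ∈ B j → v ∈ T j → u ++ v ∈ joinBlocks N B T
  joinBlocks-∈⁺ N B T j u v 1≤j j≤N u∈ v∈ =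
    ∈P.∈-concatMap⁺ (λ j → concatMap (λ u → map (u ++_) (T j)) (B j)) {range 1 N} (lose (range-∈⁺ 1 N 1≤j (s≤s j≤N))
      (∈P.∈-concatMap⁺ (λ u → map (u ++_) (T j)) {B j} (lose u∈ (∈P.∈-map⁺ (u ++_) v∈))))

  joinBlocks-unique : ∀ N B T → (∀ j → 1 ≤ j → Unique (B j)) → (∀ j u → 1 ≤ j → u ∈ B j → Block j u) →
    (∀ j → Unique (T j)) → (∀ j v → v ∈ T j → StartsBlock v) → Unique (joinBlocks N B T)
  joinBlocks-unique N B T B-unique B-block T-unique T-start =
    unique-concatMap (λ j → concatMap (λ u → map (u ++_) (T j)) (B j)) (range-unique 1 N) same-length different-length
    where
    split : ∀ {j j' u u' v v'} → u ∈ B j → u' ∈ B j' → v ∈ T j → v' ∈ T j' → 1 ≤ j → 1 ≤ j' →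
            u ++ v ≡ u' ++ v' → Block j u × Block j' u' × u ≡ u'
    split {j} {j'} {u} {u'} {v} {v'} u∈ u'∈ v∈ v'∈ 1≤j 1≤j' eq =
      B-block j u 1≤j u∈ , B-block j' u' 1≤j' u'∈ ,
      block-prefix (B-block j u 1≤j u∈) (B-block j' u' 1≤j' u'∈) (T-start j v v∈) (T-start j' v' v'∈) eq
    same-length : ∀ {j} → j ∈ range 1 N → Unique (concatMap (λ u → map (u ++_) (T j)) (B j))
    same-length {j} j∈ = unique-concatMap (λ u → map (u ++_) (T j)) (B-unique j 1≤j)
      (λ {u} _ → unique-map (u ++_) (T-unique j) (λ _ _ → LP.++-cancelˡ u _ _))
      (λ {u} {u'} u∈ u'∈ w∈ w∈' →
         let (v , v∈ , w≡uv) = ∈P.∈-map⁻ (u ++_) w∈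
             (v' , v'∈ , w≡u'v') = ∈P.∈-map⁻ (u' ++_) w∈'
         in proj₂ (proj₂ (split u∈ u'∈ v∈ v'∈ 1≤j 1≤j (trans (sym w≡uv) w≡u'v'))))
      where
      1≤j : 1 ≤ j
      1≤j = proj₁ (range-∈⁻ 1 N j∈)
    different-length : ∀ {j j' w} → j ∈ range 1 N → j' ∈ range 1 N →
      w ∈ concatMap (λ u → map (u ++_) (T j)) (B j) → w ∈ concatMap (λ u → map (u ++_) (T j')) (B j') → j ≡ j'
    different-length {j} {j'} j∈ j'∈ w∈ w∈'
      with find (∈P.∈-concatMap⁻ (λ u → map (u ++_) (T j)) {B j} w∈)
         | find (∈P.∈-concatMap⁻ (λ u → map (u ++_) (T j')) {B j'} w∈')
    ... | u , u∈ , w∈₁ | u' , u'∈ , w∈₂ with ∈P.∈-map⁻ (u ++_) w∈₁ | ∈P.∈-map⁻ (u' ++_) w∈₂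
    ... | v , v∈ , w≡uv | v' , v'∈ , w≡u'v'
      with split u∈ u'∈ v∈ v'∈ (proj₁ (range-∈⁻ 1 N j∈)) (proj₁ (range-∈⁻ 1 N j'∈)) (trans (sym w≡uv) w≡u'v')
    ... | u-block , u'-block , u≡u' =
      trans (sym (Block.length≡j u-block)) (trans (cong length u≡u') (Block.length≡j u'-block))

  -- the conditions of 𝒰^m_{b,k} except the first letter being b: length k,
  -- letters < b+m, block start, and a decomposition into U^m-blocks
  BlockWord : ℕ → Word → Set
  BlockWord k v = length v ≡ k × All (_< b ℕ.+ m) v × StartsBlock v ×
    (Σ (List Word) λ blocks →
       All (λ u → Σ ℕ λ j → 1 ≤ j × j ≤ k × InUm b m U j u) blocks × concat blocks ≡ v)

  prepend-block : ∀ N j u v → 1 ≤ j → j ≤ N → InUm b m U j u → BlockWord (N ∸ j) v → BlockWord N (u ++ v)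
  prepend-block N j u v 1≤j j≤N u∈Um (|v|≡ , v<b+m , _ , blocks , blocks∈Um , concat≡v)
    with InUm-block j u 1≤j u∈Um
  ... | block c r refl r<b b≤c c<b+m |u|≡j =
      trans (LP.length-++ (c ∷ r)) (trans (cong₂ ℕ._+_ |u|≡j |v|≡) (ℕP.m+[n∸m]≡n j≤N))
    , (c<b+m ∷ AllP.++⁺ (All.map (λ x<b → ℕP.<-≤-trans x<b (ℕP.m≤m+n b m)) r<b) v<b+m)
    , b≤c
    , (c ∷ r) ∷ blocks
    , (j , 1≤j , j≤N , u∈Um) ∷ All.map (λ (j' , 1≤j' , j'≤ , u'∈Um) → j' , 1≤j' , ℕP.≤-trans j'≤ (ℕP.m∸n≤m N j) , u'∈Um)
                                        blocks∈Um
    , cong ((c ∷ r) ++_) concat≡v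

  concats-sound : ∀ f k v → v ∈ concats f k → BlockWord k v
  concats-sound f       zero    v (here refl) = refl , [] , tt , [] , [] , refl
  concats-sound (suc f) (suc n) v v∈
    with joinBlocks-∈⁻ (suc n) Um (λ j → concats f (suc n ∸ j)) v v∈
  ... | j , u , v' , j∈ , u∈ , v'∈ , refl =
    prepend-block (suc n) j u v' 1≤j (ℕP.≤-pred (proj₂ (range-∈⁻ 1 (suc n) j∈))) (Um-∈⁻ j u 1≤j u∈)
                  (concats-sound f (suc n ∸ j) v' v'∈)
    where
    1≤j : 1 ≤ j
    1≤j = proj₁ (range-∈⁻ 1 (suc n) j∈)

  concats-start : ∀ f k v → v ∈ concats f k → StartsBlock v
  concats-start f k v v∈ = proj₁ (proj₂ (proj₂ (concats-sound f k v v∈)))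

  scriptU-sound : ∀ n w → w ∈ scriptU n → InScriptU b m U n w
  scriptU-sound n w w∈ with joinBlocks-∈⁻ n U (λ j → concats n (n ∸ j)) w w∈
  ... | j , u , v , j∈ , u∈ , v∈ , refl = first-block-from-U (U-InUm j u 1≤j u∈)
    where
    1≤j : 1 ≤ j
    1≤j = proj₁ (range-∈⁻ 1 n j∈)
    first-block-from-U : (Σ Word λ r → u ≡ b ∷ r × InUm b m U j u) → InScriptU b m U n (u ++ v)
    first-block-from-U (r , refl , u∈Um)
      with prepend-block n j (b ∷ r) v 1≤j (ℕP.≤-pred (proj₂ (range-∈⁻ 1 n j∈))) u∈Um
                         (concats-sound n (n ∸ j) v v∈)
    ... | |w|≡n , w<b+m , _ , decomposition = |w|≡n , w<b+m , (r ++ v , refl) , decomposition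

  length-after : ∀ (u v : Word) → length (u ++ v) ∸ length u ≡ length v
  length-after u v = trans (cong (_∸ length u) (LP.length-++ u)) (ℕP.m+n∸m≡n (length u) (length v))

  concats-complete : ∀ blocks → All (λ u → Σ ℕ λ j → 1 ≤ j × InUm b m U j u) blocks →
    ∀ f → length (concat blocks) ≤ f → concat blocks ∈ concats f (length (concat blocks))
  concats-complete []       []                            f _ = here refl
  concats-complete (u ∷ bl) ((j , 1≤j , u∈Um) ∷ bl∈Um) f |w|≤f with InUm-block j u 1≤j u∈Um
  ... | block c r refl _ _ _ |u|≡j = prepend f |w|≤f
    where
    v : Word
    v = concat bl
    prepend : ∀ f → length ((c ∷ r) ++ v) ≤ f → (c ∷ r) ++ v ∈ concats f (length ((c ∷ r) ++ v))
    prepend (suc f) (s≤s |rv|≤f) =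
      joinBlocks-∈⁺ (suc (length (r ++ v))) Um (λ j → concats f (suc (length (r ++ v)) ∸ j)) j (c ∷ r) v 1≤j
        (subst (_≤ suc (length (r ++ v))) |u|≡j (s≤s (LP.length-++-≤ˡ r)))
        (Um-∈⁺ j (c ∷ r) u∈Um)
        (subst (λ k → v ∈ concats f k) (sym (trans (cong (suc (length (r ++ v)) ∸_) (sym |u|≡j)) (length-after (c ∷ r) v)))
           (concats-complete bl bl∈Um f (ℕP.≤-trans (LP.length-++-≤ʳ v {r}) |rv|≤f)))

  scriptU-complete : ∀ n w → InScriptU b m U n w → w ∈ scriptU n
  scriptU-complete n w (_ , _ , (_ , w≡br) , [] , [] , concat≡w) with trans concat≡w w≡br
  ... | ()
  scriptU-complete n w (|w|≡n , _ , (_ , w≡br) , (u ∷ bl) , ((j , 1≤j , _ , u∈Um) ∷ bl∈Um) , concat≡w)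
    with InUm-block j u 1≤j u∈Um
  ... | block c r refl _ _ _ |u|≡j =
    subst₂ (λ w n → w ∈ scriptU n) concat≡w (trans (cong length concat≡w) |w|≡n) uv∈
    where
    v : Word
    v = concat bl
    N : ℕ
    N = length ((c ∷ r) ++ v)
    -- the first block starts with the first letter of w, which is b
    c≡b : c ≡ b
    c≡b = LP.∷-injectiveˡ (trans concat≡w w≡br)
    first-in-U : InUm b m U j (c ∷ r) → (c ∷ r) ∈ U j
    first-in-U (_ , _ , _ , _ , cr≡c'r' , br'∈) = subst (_∈ U j) (sym (cong₂ _∷_ c≡b (LP.∷-injectiveʳ cr≡c'r'))) br'∈
    uv∈ : (c ∷ r) ++ v ∈ scriptU N
    uv∈ = joinBlocks-∈⁺ N U (λ j → concats N (N ∸ j)) j (c ∷ r) v 1≤j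
      (subst (_≤ N) |u|≡j (LP.length-++-≤ˡ (c ∷ r)))
      (first-in-U u∈Um)
      (subst (λ k → v ∈ concats N k) (sym (trans (cong (N ∸_) (sym |u|≡j)) (length-after (c ∷ r) v)))
         (concats-complete bl (All.map (λ (j' , 1≤j' , _ , u'∈Um) → j' , 1≤j' , u'∈Um) bl∈Um) N
                           (LP.length-++-≤ʳ v {c ∷ r})))

  Um-unique : ∀ j → 1 ≤ j → Unique (Um j)
  Um-unique j 1≤j = unique-concatMap (λ c → map (relabel c) (U j)) (range-unique b m)
    (λ {c} _ → unique-map (relabel c) (U-unique j 1≤j) relabel-injective)
    (λ {c} {c'} _ _ w∈ w∈' →
       let (_ , _ , w≡cx)  = ∈P.∈-map⁻ (relabel c) w∈
           (_ , _ , w≡c'y) = ∈P.∈-map⁻ (relabel c') w∈'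
       in LP.∷-injectiveˡ (trans (sym w≡cx) w≡c'y))
    where
    -- all words of U j begin with b, so relabelling only forgets that letter
    relabel-injective : ∀ {c w w'} → w ∈ U j → w' ∈ U j → relabel c w ≡ relabel c w' → w ≡ w'
    relabel-injective {w = w} {w'} w∈ w'∈ eq with U-member j w 1≤j w∈ | U-member j w' 1≤j w'∈
    ... | _ , refl , _ | _ , refl , _ = cong (b ∷_) (LP.∷-injectiveʳ eq)

  concats-unique : ∀ f k → Unique (concats f k)
  concats-unique f       zero    = [] ∷ []
  concats-unique zero    (suc n) = []
  concats-unique (suc f) (suc n) =
    joinBlocks-unique (suc n) Um (λ j → concats f (suc n ∸ j)) Um-unique
      (λ j u 1≤j u∈ → InUm-block j u 1≤j (Um-∈⁻ j u 1≤j u∈))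
      (λ j → concats-unique f (suc n ∸ j)) (λ j → concats-start f (suc n ∸ j))

  scriptU-unique : ∀ n → Unique (scriptU n)
  scriptU-unique n = joinBlocks-unique n U (λ j → concats n (n ∸ j)) U-unique U-block
    (λ j → concats-unique n (n ∸ j)) (λ j → concats-start n (n ∸ j))

  -- Counting, with x_j = |U_j|: the concatenations are counted by
  -- H = 1 + m·Y_m, and then 𝒰^m_{b,n} by X ⊛ H = Y_m.
  xU : ℕ → ℚ
  xU j = ℕ→ℚ (length (U j))

  open Powers xU using (X)
  open IteratedInvert xU using (Y; Y-fixpoint)

  M : ℚ
  M = ℕ→ℚ m

  H : Series
  H = one ⊕ M · Y m

  X⊛H : X ⊛ H ≗ Y m
  X⊛H n = begin
    (X ⊛ (one ⊕ M · Y m)) n      ≡⟨ ⊛-distribˡ-⊕ X one (M · Y m) n ⟩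
    (X ⊛ one) n + (X ⊛ (M · Y m)) n ≡⟨ cong₂ _+_ (trans (⊛-comm X one n) (one-⊛ X n)) (⊛-·ʳ M X (Y m) n) ⟩
    X n + M * (X ⊛ Y m) n        ≡⟨ sym (Y-fixpoint m n) ⟩
    Y m n                        ∎

  X⊛-suc : ∀ A n → (X ⊛ A) (suc n) ≡ sumFrom 1 (suc n) (λ j → xU j * A (suc n ∸ j))
  X⊛-suc A n = begin
    (X ⊛ A) (suc n)                                        ≡⟨ PowerSeries.⊛-suc X A n ⟩
    0ℚ * A (suc n) + sumFrom 0 (suc n) (λ i → X (suc i) * A (n ∸ i))
      ≡⟨ cong (_+ sumFrom 0 (suc n) (λ i → X (suc i) * A (n ∸ i))) (ℚP.*-zeroˡ (A (suc n))) ⟩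
    0ℚ + sumFrom 0 (suc n) (λ i → X (suc i) * A (n ∸ i))  ≡⟨ ℚP.+-identityˡ _ ⟩
    sumFrom 0 (suc n) (λ i → X (suc i) * A (n ∸ i))       ≡⟨ sym (sum-shift 0 (suc n) (λ j → xU j * A (suc n ∸ j))) ⟩
    sumFrom 1 (suc n) (λ j → xU j * A (suc n ∸ j))        ∎

  length-Um : ∀ j → ℕ→ℚ (length (Um j)) ≡ M * xU j
  length-Um j = begin
    ℕ→ℚ (length (Um j))
      ≡⟨ length-concatMap (λ c → map (relabel c) (U j)) (range b m) ⟩
    sumℚ (map (λ c → ℕ→ℚ (length (map (relabel c) (U j)))) (range b m))
      ≡⟨ cong sumℚ (LP.map-cong (λ c → cong ℕ→ℚ (LP.length-map (relabel c) (U j))) (range b m)) ⟩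
    sumℚ (map (λ _ → xU j) (range b m))
      ≡⟨ sumℚ-const (xU j) (range b m) ⟩
    ℕ→ℚ (length (range b m)) * xU j
      ≡⟨ cong (λ L → ℕ→ℚ L * xU j) (LP.length-applyUpTo (b ℕ.+_) m) ⟩
    M * xU j ∎

  length-joinBlocks : ∀ N B T →
    ℕ→ℚ (length (joinBlocks N B T)) ≡ sumFrom 1 N (λ j → ℕ→ℚ (length (B j)) * ℕ→ℚ (length (T j)))
  length-joinBlocks N B T = begin
    ℕ→ℚ (length (joinBlocks N B T))
      ≡⟨ length-concatMap (λ j → concatMap (λ u → map (u ++_) (T j)) (B j)) (range 1 N) ⟩
    sumℚ (map (λ j → ℕ→ℚ (length (concatMap (λ u → map (u ++_) (T j)) (B j)))) (range 1 N))
      ≡⟨ cong sumℚ (LP.map-cong (λ j → length-prefixed (B j) (T j)) (range 1 N)) ⟩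
    sumℚ (map count (range 1 N))
      ≡⟨ sumℚ-applyUpTo count (1 ℕ.+_) N ⟩
    sumFrom 0 N (λ i → count (suc i))
      ≡⟨ sym (sum-shift 0 N count) ⟩
    sumFrom 1 N count ∎
    where
    count : ℕ → ℚ
    count j = ℕ→ℚ (length (B j)) * ℕ→ℚ (length (T j))
    length-prefixed : ∀ (Bⱼ Tⱼ : List Word) →
      ℕ→ℚ (length (concatMap (λ u → map (u ++_) Tⱼ) Bⱼ)) ≡ ℕ→ℚ (length Bⱼ) * ℕ→ℚ (length Tⱼ)
    length-prefixed Bⱼ Tⱼ = begin
      ℕ→ℚ (length (concatMap (λ u → map (u ++_) Tⱼ) Bⱼ))
        ≡⟨ length-concatMap (λ u → map (u ++_) Tⱼ) Bⱼ ⟩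
      sumℚ (map (λ u → ℕ→ℚ (length (map (u ++_) Tⱼ))) Bⱼ)
        ≡⟨ cong sumℚ (LP.map-cong (λ u → cong ℕ→ℚ (LP.length-map (u ++_) Tⱼ)) Bⱼ) ⟩
      sumℚ (map (λ _ → ℕ→ℚ (length Tⱼ)) Bⱼ)
        ≡⟨ sumℚ-const (ℕ→ℚ (length Tⱼ)) Bⱼ ⟩
      ℕ→ℚ (length Bⱼ) * ℕ→ℚ (length Tⱼ) ∎

  length-concats : ∀ f n → n ≤ f → ℕ→ℚ (length (concats f n)) ≡ H n
  length-concats f zero _ = sym (trans (cong (1ℚ +_) (ℚP.*-zeroʳ M)) (ℚP.+-identityʳ 1ℚ))
  length-concats (suc f) (suc n) (s≤s n≤f) = begin
    ℕ→ℚ (length (concats (suc f) (suc n)))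
      ≡⟨ length-joinBlocks (suc n) Um (λ j → concats f (suc n ∸ j)) ⟩
    sumFrom 1 (suc n) (λ j → ℕ→ℚ (length (Um j)) * ℕ→ℚ (length (concats f (suc n ∸ j))))
      ≡⟨ sum-cong-on 1 (suc n) term ⟩
    sumFrom 1 (suc n) (λ j → M * (xU j * H (suc n ∸ j)))
      ≡⟨ sum-*ˡ 1 (suc n) M (λ j → xU j * H (suc n ∸ j)) ⟩
    M * sumFrom 1 (suc n) (λ j → xU j * H (suc n ∸ j))
      ≡⟨ cong (M *_) (sym (X⊛-suc H n)) ⟩
    M * (X ⊛ H) (suc n)
      ≡⟨ cong (M *_) (X⊛H (suc n)) ⟩
    M * Y m (suc n)
      ≡⟨ sym (ℚP.+-identityˡ _) ⟩
    H (suc n) ∎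
    where
    term : ∀ j → 1 ≤ j → j < 1 ℕ.+ suc n →
           ℕ→ℚ (length (Um j)) * ℕ→ℚ (length (concats f (suc n ∸ j))) ≡ M * (xU j * H (suc n ∸ j))
    term (suc j) _ _ = begin
      ℕ→ℚ (length (Um (suc j))) * ℕ→ℚ (length (concats f (n ∸ j)))
        ≡⟨ cong₂ _*_ (length-Um (suc j)) (length-concats f (n ∸ j) (ℕP.≤-trans (ℕP.m∸n≤m n j) n≤f)) ⟩
      (M * xU (suc j)) * H (n ∸ j)
        ≡⟨ ℚP.*-assoc M (xU (suc j)) (H (n ∸ j)) ⟩
      M * (xU (suc j) * H (n ∸ j)) ∎

  length-scriptU : ∀ n → ℕ→ℚ (length (scriptU (suc n))) ≡ Y m (suc n)
  length-scriptU n = begin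
    ℕ→ℚ (length (scriptU (suc n)))
      ≡⟨ length-joinBlocks (suc n) U (λ j → concats (suc n) (suc n ∸ j)) ⟩
    sumFrom 1 (suc n) (λ j → xU j * ℕ→ℚ (length (concats (suc n) (suc n ∸ j))))
      ≡⟨ sum-cong 1 (suc n) (λ j → cong (xU j *_) (length-concats (suc n) (suc n ∸ j) (ℕP.m∸n≤m (suc n) j))) ⟩
    sumFrom 1 (suc n) (λ j → xU j * H (suc n ∸ j))
      ≡⟨ sym (X⊛-suc H n) ⟩
    (X ⊛ H) (suc n)
      ≡⟨ X⊛H (suc n) ⟩
    Y m (suc n) ∎

-- The theorem: the enumeration scriptU n of 𝒰^m_{b,n} has f_m(n) = [tⁿ] Y_m
-- elements (counted via |U_j| = f₀(j)), and f_m is the m-th iterated invert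
-- transform of f₀ as [tⁿ] Y_m is.
mainTheorem3 :
    (b m : ℕ) → 1 ≤ b → 1 ≤ m →
    (f₀ : ℕ → ℕ) → (∀ j → 1 ≤ j → f₀ j ≤ b ^ (j ∸ 1)) →
    (U : ℕ → List Word) →
    (∀ j → 1 ≤ j → Unique (U j) × All (InW b j) (U j) × length (U j) ≡ f₀ j) →
    (∀ n → 1 ≤ n →
       Σ (List Word) λ L →
         Unique L × (∀ w → (w ∈ L) ⇔ InScriptU b m U n w) × fSeq m f₀ n ≡ ℕ→ℚ (length L))
    × IsIteratedInvert m (λ n → ℕ→ℚ (f₀ n)) (fSeq m f₀)
mainTheorem3 b m _ 1≤m f₀ _ U hU = counting , iterated
  where
  open ≡-Reasoning
  open Words b m 1≤m U (λ j 1≤j → proj₁ (hU j 1≤j)) (λ j 1≤j → proj₁ (proj₂ (hU j 1≤j)))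

  x : ℕ → ℚ
  x j = ℕ→ℚ (f₀ j)

  |U|≡f₀ : ∀ j → xU (suc j) ≡ x (suc j)
  |U|≡f₀ j = cong ℕ→ℚ (proj₂ (proj₂ (hU (suc j) (s≤s z≤n))))

  counting : ∀ n → 1 ≤ n → Σ (List Word) λ L →
    Unique L × (∀ w → (w ∈ L) ⇔ InScriptU b m U n w) × fSeq m f₀ n ≡ ℕ→ℚ (length L)
  counting (suc n) _ =
    scriptU (suc n) , scriptU-unique (suc n) ,
    (λ w → mk⇔ (scriptU-sound (suc n) w) (scriptU-complete (suc n) w)) ,
    (begin
      fSeq m f₀ (suc n)                  ≡⟨ fSeq-as-Y f₀ m n ⟩
      IteratedInvert.Y x m (suc n)       ≡⟨ sym (Y-cong {xU} {x} |U|≡f₀ m (suc n)) ⟩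
      IteratedInvert.Y xU m (suc n)      ≡⟨ sym (length-scriptU n) ⟩
      ℕ→ℚ (length (scriptU (suc n)))     ∎)

  iterated : IsIteratedInvert m x (fSeq m f₀)
  iterated = iterated-congʳ m (λ n → sym (fSeq-as-Y f₀ m n)) (IteratedInvert.Y-iterated x m)
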